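{- Let $A=\begin{pmatrix} a & b\\ c & d\end{pmatrix}\in \mathrm{SL}_2(\mathbb{Z})$ with $c>0$ and $d\neq 0$. If $d>0$, then with $S=\begin{pmatrix} 0 & -1\\ 1 & 0\end{pmatrix}$ (so $AS=\begin{pmatrix} b & -a\\ d & -c\end{pmatrix}$) we have $\epsilon_1(AS)=e^{ -3\pi i/4}\epsilon_1(A)$. If $d<0$, then with $S=\begin{pmatrix} 0 & 1\\ -1 & 0\end{pmatrix}$ (so $AS=\begin{pmatrix} -b & a\\ -d & c\end{pmatrix}$) we have $\epsilon_1(AS)=e^{3\pi i/4}\epsilon_1(A)$.
   Context: For integers $h,k$ with $k>0$ and $\gcd(h,k)=1$, the Dedekind sum is $s(h,k)=\sum_{r=1}^{k-1}\frac{r}{k}\left(\frac{hr}{k}-\left\lfloor\frac{hr}{k}\right\rfloor-\frac12\right)$. For a matrix $M=\begin{pmatrix} \alpha & \beta\\ \gamma & \delta\end{pmatrix}\in\mathrm{SL}_2(\mathbb{Z})$ with $\gamma>0$, define $\epsilon_1(M)=-i\,\exp\!\left(3\pi i\left(\frac{\alpha+\delta}{12\gamma}-s(\delta,\gamma)\right)\right)$. -}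

module Defs where

open import Data.Nat as ℕ using (ℕ; zero; suc)
open import Data.Integer as ℤ using (ℤ; +_; +[1+_]; -[1+_])
open import Data.Rational as ℚ using (ℚ; floor; ½)
open import Data.Product using (∃)
open import Relation.Binary.PropositionalEquality using (_≡_)
open import Data.Empty using (⊥-elim)
open import Data.Integer using (+<+; -<+)
open import Data.Nat using (z<s)

sumFrom1 : ℕ → (ℕ → ℚ) → ℚ
sumFrom1 zero f = ℚ.0ℚ
sumFrom1 (suc zero) f = ℚ.0ℚ
sumFrom1 (suc (suc n)) f = sumFrom1 (suc n) f ℚ.+ f (suc n)

dedekind : ℤ → (k : ℕ) → .{{_ : ℕ.NonZero k}} → ℚ
dedekind h k = sumFrom1 k λ r →
  (+ r ℚ./ k) ℚ.* ((h ℤ.* + r) ℚ./ k ℚ.- (floor ((h ℤ.* + r) ℚ./ k) ℚ./ 1) ℚ.- ½)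

record Mat : Set where
  constructor mat
  field
    α β γ δ : ℤ
open Mat public

_·_ : Mat → Mat → Mat
mat a b c d · mat a' b' c' d' =
  mat (a ℤ.* a' ℤ.+ b ℤ.* c') (a ℤ.* b' ℤ.+ b ℤ.* d')
      (c ℤ.* a' ℤ.+ d ℤ.* c') (c ℤ.* b' ℤ.+ d ℤ.* d')

det : Mat → ℤ
det (mat a b c d) = a ℤ.* d ℤ.- b ℤ.* c

IsSL2 : Mat → Set
IsSL2 M = det M ≡ + 1

-- Points of the unit circle of the form e^{π i t} with t ∈ ℚ are represented
-- by their angle t (in units of π).  Multiplication is addition of angles,
-- and two angles give the same complex number iff they differ by an even integer.
Phase : Set
Phase = ℚ

e^πi : ℚ → Phase
e^πi t = t

_⊙_ : Phase → Phase → Phase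
s ⊙ t = s ℚ.+ t

infixl 7 _⊙_
infix 4 _≈ᵤ_

_≈ᵤ_ : Phase → Phase → Set
s ≈ᵤ t = ∃ λ (z : ℤ) → s ℚ.- t ≡ (+ 2 ℤ.* z) ℚ./ 1

-i : Phase
-i = e^πi (ℚ.- ½)

ε₁ : (M : Mat) → ℤ.0ℤ ℤ.< γ M → Phase
ε₁ (mat a b (+ zero) d) (+<+ ())
ε₁ (mat a b +[1+ n ] d) _ =
  -i ⊙ e^πi (+ 3 ℚ./ 1 ℚ.* ((a ℤ.+ d) ℚ./ (12 ℕ.* suc n) ℚ.- dedekind d (suc n)))

{-# OPTIONS --safe #-}
-- Write θ(α, δ, γ) = -1/2 + 3 ((α + δ)/(12γ) - s(δ, γ)), so that ε₁ = exp(πi θ). For d > 0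
-- the matrix AS has lower row (d, -c), and s(-c, d) = -s(c, d) by coprimality, so
--   θ(AS) - θ(A) = (b - c)/(4d) - (a + d)/(4c) + 3 (s(c, d) + s(d, c)).
-- Dedekind reciprocity s(c, d) + s(d, c) = -1/4 + (c/d + d/c + 1/(cd))/12 turns this into
-- (bc - ad + 1)/(4cd) - 3/4 = -3/4. Negating α and δ sends θ to -1 - θ, which reduces the
-- case d < 0 to the case d > 0 for the matrix (-a, b; c, -d).
--
-- Reciprocity is proved for the integers N(h, k) = 2k² s(h, k) = Σ r (2 (hr mod k) - k).
-- Writing hr mod k = hr - k f(r) with f(r) = ⌊hr/k⌋, multiplication by h permutes the
-- residues mod k, so Σ (hr - k f(r))² = Σ r². Counting the lattice points below the line
-- ks = hr by rows and by columns expresses Σ f(r)² and Σ f(r) through Σ s g(s) and Σ g(s),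
-- g(s) = ⌊ks/h⌋. Eliminating gives one identity for each orientation (h, k) and (k, h);
-- weighted by h and k they add up to (h + k) times the reciprocity law, the floor sums
-- entering only through Σ f + Σ g = (h - 1)(k - 1).
module Submission where

open import Defs

open import Data.Empty using (⊥-elim)
open import Data.Fin using (Fin; toℕ; fromℕ<)
import Data.Fin.Properties as Fin
open import Data.Fin.Permutation using (Permutation; permutation)
open import Data.Integer as ℤ
  using (ℤ; +_; -_; _+_; _-_; _*_; _≤_; _<_; 0ℤ; 1ℤ; +[1+_]; -[1+_]; +≤+; +<+; ∣_∣)
import Data.Integer.DivMod as ℤ
open import Data.Integer.GCD using (gcd)
import Data.Integer.Properties as ℤ
open import Algebra.Properties.CommutativeMonoid.Sum ℤ.+-0-commutativeMonoid using (sum; sum-cong-≗; ∑-permute)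
open import Data.Integer.Tactic.RingSolver using (solve-∀; solve)
open import Data.List using (_∷_; [])
open import Data.Maybe using (just; nothing)
open import Data.Nat as ℕ using (ℕ; zero; suc; z≤n; s≤s)
import Data.Nat.GCD as ℕ
import Data.Nat.Properties as ℕ
open import Data.Product using (_×_; _,_; proj₁; proj₂; uncurry)
open import Data.Rational as ℚ using (ℚ; _/_; ½)
import Data.Rational.Properties as ℚ
import Data.Rational.Unnormalised as ℚᵘ
import Data.Rational.Unnormalised.Properties as ℚᵘ
open import Data.Sum using (inj₂)
open import Function using (case_of_)
open import Level using (0ℓ)
open import Relation.Binary.PropositionalEquality
  using (_≡_; _≢_; refl; sym; trans; cong; cong₂; subst; subst₂; module ≡-Reasoning)
open import Relation.Nullary using (¬_; Dec; yes; no)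
import Tactic.RingSolver as ℚ-Solver
open import Tactic.RingSolver.Core.AlmostCommutativeRing using (AlmostCommutativeRing; fromCommutativeRing)

-- Sums over initial segments of ℕ

∑< : ℕ → (ℕ → ℤ) → ℤ
∑< zero    f = 0ℤ
∑< (suc n) f = ∑< n f + f n

infix 5 ∑<
syntax ∑< n (λ i → e) = ∑[ i < n ] e

∑-cong : ∀ n {f g : ℕ → ℤ} → (∀ i → i ℕ.< n → f i ≡ g i) → ∑< n f ≡ ∑< n g
∑-cong zero    f≗g = refl
∑-cong (suc n) f≗g = cong₂ _+_ (∑-cong n λ i i<n → f≗g i (ℕ.m<n⇒m<1+n i<n)) (f≗g n ℕ.≤-refl)

∑-+ : ∀ n (f g : ℕ → ℤ) → ∑[ i < n ] (f i + g i) ≡ ∑< n f + ∑< n g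
∑-+ zero    f g = refl
∑-+ (suc n) f g = trans (cong (_+ (f n + g n)) (∑-+ n f g)) (interchange (∑< n f) (∑< n g) (f n) (g n))
  where
  interchange : ∀ a b c d → a + b + (c + d) ≡ a + c + (b + d)
  interchange = solve-∀

∑-*ˡ : ∀ n c (f : ℕ → ℤ) → ∑[ i < n ] (c * f i) ≡ c * ∑< n f
∑-*ˡ zero    c f = sym (ℤ.*-zeroʳ c)
∑-*ˡ (suc n) c f = trans (cong (_+ c * f n) (∑-*ˡ n c f)) (sym (ℤ.*-distribˡ-+ c (∑< n f) (f n)))

∑-neg : ∀ n (f : ℕ → ℤ) → ∑[ i < n ] (- f i) ≡ - ∑< n f
∑-neg zero    f = refl
∑-neg (suc n) f = trans (cong (_+ - f n) (∑-neg n f)) (sym (ℤ.neg-distrib-+ (∑< n f) (f n)))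

∑-linear : ∀ n a b (f g : ℕ → ℤ) → ∑[ i < n ] (a * f i + b * g i) ≡ a * ∑< n f + b * ∑< n g
∑-linear n a b f g = trans (∑-+ n (λ i → a * f i) (λ i → b * g i)) (cong₂ _+_ (∑-*ˡ n a f) (∑-*ˡ n b g))

∑-linear₃ : ∀ n a b c (f g h : ℕ → ℤ) →
            ∑[ i < n ] (a * f i + b * g i + c * h i) ≡ a * ∑< n f + b * ∑< n g + c * ∑< n h
∑-linear₃ n a b c f g h = trans (∑-+ n (λ i → a * f i + b * g i) (λ i → c * h i))
                                (cong₂ _+_ (∑-linear n a b f g) (∑-*ˡ n c h))

∑-const : ∀ n c → ∑< n (λ _ → c) ≡ + n * c
∑-const zero    c = refl
∑-const (suc n) c = trans (cong (_+ c) (∑-const n c)) (step (+ n) c)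
  where
  step : ∀ m c → m * c + c ≡ (1ℤ + m) * c
  step = solve-∀

∑-1 : ∀ n → ∑< n (λ _ → 1ℤ) ≡ + n
∑-1 n = trans (∑-const n 1ℤ) (ℤ.*-identityʳ (+ n))

∑-suc : ∀ n (f : ℕ → ℤ) → ∑< (suc n) f ≡ f 0 + (∑[ i < n ] f (suc i))
∑-suc zero    f = ℤ.+-comm 0ℤ (f 0)
∑-suc (suc n) f = trans (cong (_+ f (suc n)) (∑-suc n f)) (ℤ.+-assoc (f 0) _ _)

∑-suc-zero : ∀ n (f : ℕ → ℤ) → f 0 ≡ 0ℤ → ∑< (suc n) f ≡ ∑[ i < n ] f (suc i)
∑-suc-zero n f f0≡0 = trans (∑-suc n f) (trans (cong (_+ (∑[ i < n ] f (suc i))) f0≡0) (ℤ.+-identityˡ _))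

∑-comm : ∀ m n (f : ℕ → ℕ → ℤ) → ∑[ i < m ] ∑[ j < n ] f i j ≡ ∑[ j < n ] ∑[ i < m ] f i j
∑-comm zero    n f = sym (trans (∑-const n 0ℤ) (ℤ.*-zeroʳ (+ n)))
∑-comm (suc m) n f = trans (cong (_+ (∑[ j < n ] f m j)) (∑-comm m n f))
                           (sym (∑-+ n (λ j → ∑[ i < m ] f i j) (f m)))

∑<-as-sum : ∀ n (f : ℕ → ℤ) → ∑< n f ≡ sum {n} (λ i → f (toℕ i))
∑<-as-sum zero    f = refl
∑<-as-sum (suc n) f = trans (∑-suc n f) (cong (_+_ (f 0)) (∑<-as-sum n (λ i → f (suc i))))

∑-naturals : ∀ n → + 2 * (∑[ i < n ] + i) ≡ + n * (+ n - 1ℤ)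
∑-naturals zero    = refl
∑-naturals (suc n) = trans (ℤ.*-distribˡ-+ (+ 2) (∑[ i < n ] + i) (+ n))
                           (trans (cong (_+ + 2 * + n) (∑-naturals n)) (step (+ n)))
  where
  step : ∀ m → m * (m - 1ℤ) + + 2 * m ≡ (1ℤ + m) * ((1ℤ + m) - 1ℤ)
  step = solve-∀

∑-squares : ∀ n → + 6 * (∑[ i < n ] + i * + i) ≡ (+ n - 1ℤ) * + n * (+ 2 * + n - 1ℤ)
∑-squares zero    = refl
∑-squares (suc n) = trans (ℤ.*-distribˡ-+ (+ 6) (∑[ i < n ] + i * + i) (+ n * + n))
                          (trans (cong (_+ + 6 * (+ n * + n)) (∑-squares n)) (step (+ n)))
  where
  step : ∀ m → (m - 1ℤ) * m * (+ 2 * m - 1ℤ) + + 6 * (m * m)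
             ≡ ((1ℤ + m) - 1ℤ) * (1ℤ + m) * (+ 2 * (1ℤ + m) - 1ℤ)
  step = solve-∀

∑-odd : ∀ n → ∑[ i < n ] (+ 2 * + i - 1ℤ) ≡ + n * + n - + 2 * + n
∑-odd zero    = refl
∑-odd (suc n) = trans (cong (_+ (+ 2 * + n - 1ℤ)) (∑-odd n)) (step (+ n))
  where
  step : ∀ m → m * m - + 2 * m + (+ 2 * m - 1ℤ) ≡ (1ℤ + m) * (1ℤ + m) - + 2 * (1ℤ + m)
  step = solve-∀

𝟙 : {P : Set} → Dec P → ℤ
𝟙 (yes _) = 1ℤ
𝟙 (no _)  = 0ℤ

𝟙-< : ∀ a b → 𝟙 (a ℤ.<? b) ≡ 1ℤ - 𝟙 (b ℤ.≤? a)
𝟙-< a b with a ℤ.<? b | b ℤ.≤? a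
... | yes a<b | yes b≤a = ⊥-elim (ℤ.<⇒≱ a<b b≤a)
... | yes _   | no _    = refl
... | no _    | yes _   = refl
... | no a≮b  | no b≰a  = ⊥-elim (a≮b (ℤ.≰⇒> b≰a))

module _ {P : ℕ → Set} (P? : ∀ s → Dec (P s)) (F : ℕ)
         (≤F⇒P : ∀ s → s ℕ.≤ F → P s) (F<⇒¬P : ∀ s → F ℕ.< s → ¬ P s) where

  private
    ∑-𝟙-initial : ∀ (w : ℕ → ℤ) n → n ℕ.≤ suc F → ∑[ s < n ] 𝟙 (P? s) * w s ≡ ∑< n w
    ∑-𝟙-initial w zero    _     = refl
    ∑-𝟙-initial w (suc n) n<1+F with P? n
    ... | yes _  = cong₂ _+_ (∑-𝟙-initial w n (ℕ.<⇒≤ n<1+F)) (ℤ.*-identityˡ (w n))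
    ... | no ¬Pn = ⊥-elim (¬Pn (≤F⇒P n (ℕ.s≤s⁻¹ n<1+F)))

    ∑-𝟙-beyond : ∀ (w : ℕ → ℤ) d → ∑[ s < d ℕ.+ suc F ] 𝟙 (P? s) * w s ≡ ∑< (suc F) w
    ∑-𝟙-beyond w zero    = ∑-𝟙-initial w (suc F) ℕ.≤-refl
    ∑-𝟙-beyond w (suc d) with P? (d ℕ.+ suc F)
    ... | yes P[d+1+F] = ⊥-elim (F<⇒¬P _ (ℕ.m≤n+m (suc F) d) P[d+1+F])
    ... | no _         = trans (ℤ.+-identityʳ _) (∑-𝟙-beyond w d)

  ∑-𝟙-prefix : ∀ (w : ℕ → ℤ) n → F ℕ.< n → ∑[ s < n ] 𝟙 (P? s) * w s ≡ ∑< (suc F) w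
  ∑-𝟙-prefix w n F<n =
    subst (λ m → ∑[ s < m ] 𝟙 (P? s) * w s ≡ ∑< (suc F) w) (ℕ.m∸n+n≡m F<n) (∑-𝟙-beyond w (n ℕ.∸ suc F))

  ∑-𝟙-count : ∀ n → F ℕ.< n → ∑[ s < n ] 𝟙 (P? s) ≡ + suc F
  ∑-𝟙-count n F<n = trans (∑-cong n λ s _ → sym (ℤ.*-identityʳ (𝟙 (P? s))))
                          (trans (∑-𝟙-prefix (λ _ → 1ℤ) n F<n) (∑-1 (suc F)))

-- Floors and remainders

⌊_/_⌋ : ℤ → (k : ℕ) → .{{ℕ.NonZero k}} → ℤ
⌊ i / k ⌋ = ℚ.floor (i / k)

rem : ℤ → (k : ℕ) → .{{ℕ.NonZero k}} → ℤ
rem i k = i - + k * ⌊ i / k ⌋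

div-bounds : ∀ n m → +[1+ m ] * (n ℤ./ +[1+ m ]) ≤ n × n < +[1+ m ] * (n ℤ./ +[1+ m ]) + +[1+ m ]
div-bounds n m = subst (d * q ≤_) (sym n≡r+dq) (ℤ.i≤j+i (d * q) r)
               , subst (_< d * q + d) (sym n≡r+dq)
                   (subst (r + d * q <_) (ℤ.+-comm d (d * q)) (ℤ.+-monoˡ-< (d * q) (+<+ (ℤ.n%d<d n d))))
  where
  d = +[1+ m ]
  q = n ℤ./ d
  r = + (n ℤ.% d)
  n≡r+dq : n ≡ r + d * q
  n≡r+dq = trans (ℤ.a≡a%n+[a/n]*n n d) (cong (_+_ r) (ℤ.*-comm q d))

floor-bounds-ℚ : ∀ p → ℚ.↧ p * ℚ.floor p ≤ ℚ.↥ p × ℚ.↥ p < ℚ.↧ p * ℚ.floor p + ℚ.↧ p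
floor-bounds-ℚ (ℚ.mkℚ n d _) = div-bounds n d

-- i / k is stored in lowest terms, i = ↥ p * g and k = ↧ p * g with g = gcd i k.
floor-bounds : ∀ i k .{{_ : ℕ.NonZero k}} → + k * ⌊ i / k ⌋ ≤ i × i < + k * ⌊ i / k ⌋ + + k
floor-bounds i k =
    subst₂ _≤_ (rescale (ℚ.↧ p) ⌊ i / k ⌋ (ℚ.↧-/ i k)) (ℚ.↥-/ i k) (ℤ.*-monoʳ-≤-nonNeg g (proj₁ (floor-bounds-ℚ p)))
  , subst₂ _<_ (ℚ.↥-/ i k) (rescale+ (ℚ.↧ p) ⌊ i / k ⌋ (ℚ.↧-/ i k)) (ℤ.*-monoʳ-<-pos g (proj₂ (floor-bounds-ℚ p)))
  where
  p = i / k
  g = gcd i (+ k)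
  instance
    g-pos : ℤ.Positive g
    g-pos = ℤ.positive (+<+ (ℕ.n≢0⇒n>0 (ℕ.gcd[m,n]≢0 ∣ i ∣ k (inj₂ (ℕ.≢-nonZero⁻¹ k)))))
  rescale : ∀ d q → d * g ≡ + k → d * q * g ≡ + k * q
  rescale d q dg≡k = trans (regroup d q g) (cong (_* q) dg≡k)
    where
    regroup : ∀ d q g → d * q * g ≡ d * g * q
    regroup = solve-∀
  rescale+ : ∀ d q → d * g ≡ + k → (d * q + d) * g ≡ + k * q + + k
  rescale+ d q dg≡k = trans (regroup d q g) (cong (λ k → k * q + k) dg≡k)
    where
    regroup : ∀ d q g → (d * q + d) * g ≡ d * g * q + d * g
    regroup = solve-∀

floor-≤ : ∀ i k q .{{_ : ℕ.NonZero k}} → q ≤ ⌊ i / k ⌋ → + k * q ≤ i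
floor-≤ i k q q≤⌊i/k⌋ = ℤ.≤-trans (ℤ.*-monoˡ-≤-nonNeg (+ k) q≤⌊i/k⌋) (proj₁ (floor-bounds i k))

floor-< : ∀ i k q .{{_ : ℕ.NonZero k}} → ⌊ i / k ⌋ < q → i < + k * q
floor-< i k q ⌊i/k⌋<q = ℤ.<-≤-trans (proj₂ (floor-bounds i k))
  (subst (_≤ + k * q) (distrib (+ k) ⌊ i / k ⌋) (ℤ.*-monoˡ-≤-nonNeg (+ k) (ℤ.i<j⇒suc[i]≤j ⌊i/k⌋<q)))
  where
  distrib : ∀ k q → k * (1ℤ + q) ≡ k * q + k
  distrib = solve-∀

floor-unique : ∀ i k q .{{_ : ℕ.NonZero k}} → + k * q ≤ i → i < + k * q + + k → ⌊ i / k ⌋ ≡ q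
floor-unique i k q kq≤i i<kq+k = ℤ.≤-antisym
  (ℤ.≮⇒≥ λ q<⌊i/k⌋ → ℤ.<⇒≱ i<kq+k
    (subst (_≤ i) (distrib (+ k) q) (floor-≤ i k (1ℤ + q) (ℤ.i<j⇒suc[i]≤j q<⌊i/k⌋))))
  (ℤ.≮⇒≥ λ ⌊i/k⌋<q → ℤ.<⇒≱ (floor-< i k q ⌊i/k⌋<q) kq≤i)
  where
  distrib : ∀ k q → k * (1ℤ + q) ≡ k * q + k
  distrib = solve-∀

floor-zero : ∀ a k .{{_ : ℕ.NonZero k}} → ⌊ a * + 0 / k ⌋ ≡ 0ℤ
floor-zero a k = trans (cong (λ z → ℚ.floor (z / k)) (ℤ.*-zeroʳ a)) (cong ℚ.floor (ℚ.0/n≡0 k))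

floor-nonNeg-< : ∀ i k m .{{_ : ℕ.NonZero k}} → 0ℤ ≤ i → i < + k * m → 0ℤ ≤ ⌊ i / k ⌋ × ⌊ i / k ⌋ < m
floor-nonNeg-< i k m 0≤i i<km =
    ℤ.≮⇒≥ (λ ⌊i/k⌋<0 → ℤ.<⇒≱ (floor-< i k 0ℤ ⌊i/k⌋<0) (subst (_≤ i) (sym (ℤ.*-zeroʳ (+ k))) 0≤i))
  , ℤ.*-cancelˡ-<-nonNeg (+ k) (ℤ.≤-<-trans (proj₁ (floor-bounds i k)) i<km)

nonNeg-< : ∀ {i n} → 0ℤ ≤ i → i < + n → + ∣ i ∣ ≡ i × ∣ i ∣ ℕ.< n
nonNeg-< 0≤i i<n = ℤ.0≤i⇒+∣i∣≡i 0≤i , ℤ.drop‿+<+ (subst (_< _) (sym (ℤ.0≤i⇒+∣i∣≡i 0≤i)) i<n)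

rem-bounds : ∀ i k .{{_ : ℕ.NonZero k}} → 0ℤ ≤ rem i k × rem i k < + k
rem-bounds i k = ℤ.i≤j⇒0≤j-i (proj₁ (floor-bounds i k))
               , subst (rem i k <_) (cancel (+ k * ⌊ i / k ⌋) (+ k))
                   (ℤ.+-monoˡ-< (- (+ k * ⌊ i / k ⌋)) (proj₂ (floor-bounds i k)))
  where
  cancel : ∀ a k → a + k - a ≡ k
  cancel = solve-∀

rem-+-multiple : ∀ j k q .{{_ : ℕ.NonZero k}} → 0ℤ ≤ j → j < + k → rem (j + + k * q) k ≡ j
rem-+-multiple j k q 0≤j j<k = trans (cong (λ x → j + + k * q - + k * x) ⌊j+kq/k⌋≡q) (cancel j (+ k * q))
  where
  cancel : ∀ j a → j + a - a ≡ j
  cancel = solve-∀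
  ⌊j+kq/k⌋≡q : ⌊ j + + k * q / k ⌋ ≡ q
  ⌊j+kq/k⌋≡q = floor-unique (j + + k * q) k q
    (subst (_≤ j + + k * q) (ℤ.+-identityˡ (+ k * q)) (ℤ.+-monoˡ-≤ (+ k * q) 0≤j))
    (subst (j + + k * q <_) (ℤ.+-comm (+ k) (+ k * q)) (ℤ.+-monoˡ-< (+ k * q) j<k))

rem-neg : ∀ i k .{{_ : ℕ.NonZero k}} → rem i k ≢ 0ℤ → rem (- i) k ≡ + k - rem i k
rem-neg i k rem≢0 = trans (cong (λ x → - i - + k * x) ⌊-i/k⌋≡-q-1) (rearrange i (+ k) q)
  where
  q = ⌊ i / k ⌋
  rearrange : ∀ i k q → - i - k * (- q - 1ℤ) ≡ k - (i - k * q)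
  rearrange = solve-∀
  kq<i : + k * q < i
  kq<i = ℤ.≤∧≢⇒< (proj₁ (floor-bounds i k))
           λ kq≡i → rem≢0 (trans (cong (_- + k * q) (sym kq≡i)) (ℤ.+-inverseʳ (+ k * q)))
  ⌊-i/k⌋≡-q-1 : ⌊ - i / k ⌋ ≡ - q - 1ℤ
  ⌊-i/k⌋≡-q-1 = floor-unique (- i) k (- q - 1ℤ)
    (subst (_≤ - i) (lower (+ k) q) (ℤ.neg-mono-≤ (ℤ.<⇒≤ (proj₂ (floor-bounds i k)))))
    (subst (- i <_) (upper (+ k) q) (ℤ.neg-mono-< kq<i))
    where
    lower : ∀ k q → - (k * q + k) ≡ k * (- q - 1ℤ)
    lower = solve-∀
    upper : ∀ k q → - (k * q) ≡ k * (- q - 1ℤ) + k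
    upper = solve-∀

module _ (k : ℕ) .{{_ : ℕ.NonZero k}} where

  rem-inverse : ∀ a b t → b * a ≡ 1ℤ + + k * t → ∀ j → j ℕ.< k → ∣ rem (b * + ∣ rem (a * + j) k ∣) k ∣ ≡ j
  rem-inverse a b t ba≡1+kt j j<k = ℤ.+-injective (begin
    + ∣ rem (b * + ∣ rem (a * + j) k ∣) k ∣ ≡⟨ +∣rem∣≡rem (b * + ∣ rem (a * + j) k ∣) ⟩
    rem (b * + ∣ rem (a * + j) k ∣) k       ≡⟨ cong (λ x → rem (b * x) k) (+∣rem∣≡rem (a * + j)) ⟩
    rem (b * (a * + j - + k * f)) k         ≡⟨ cong (λ x → rem x k) b*rem≡ ⟩
    rem (+ j + + k * (t * + j - b * f)) k   ≡⟨ rem-+-multiple (+ j) k _ (+≤+ z≤n) (+<+ j<k) ⟩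
    + j                                     ∎)
    where
    open ≡-Reasoning
    f = ⌊ a * + j / k ⌋
    +∣rem∣≡rem : ∀ i → + ∣ rem i k ∣ ≡ rem i k
    +∣rem∣≡rem i = ℤ.0≤i⇒+∣i∣≡i (proj₁ (rem-bounds i k))
    b*rem≡ : b * (a * + j - + k * f) ≡ + j + + k * (t * + j - b * f)
    b*rem≡ = begin
      b * (a * + j - + k * f)              ≡⟨ expand b a (+ j) (+ k) f ⟩
      b * a * + j - b * (+ k * f)          ≡⟨ cong (λ x → x * + j - b * (+ k * f)) ba≡1+kt ⟩
      (1ℤ + + k * t) * + j - b * (+ k * f) ≡⟨ regroup (+ j) (+ k) t b f ⟩
      + j + + k * (t * + j - b * f)        ∎
      where
      expand : ∀ b a j k f → b * (a * j - k * f) ≡ b * a * j - b * (k * f)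
      expand = solve-∀
      regroup : ∀ j k t b f → (1ℤ + k * t) * j - b * (k * f) ≡ j + k * (t * j - b * f)
      regroup = solve-∀

  ∑-rem-permute : ∀ a b t → b * a ≡ 1ℤ + + k * t → (φ : ℕ → ℤ) → ∑[ r < k ] φ ∣ rem (a * + r) k ∣ ≡ ∑< k φ
  ∑-rem-permute a b t ba≡1+kt φ = begin
    ∑[ r < k ] φ ∣ rem (a * + r) k ∣              ≡⟨ ∑<-as-sum k (λ r → φ ∣ rem (a * + r) k ∣) ⟩
    sum {k} (λ i → φ ∣ rem (a * + toℕ i) k ∣)     ≡⟨ sum-cong-≗ {k} (λ i → cong φ (Fin.toℕ-fromℕ< (∣rem∣<k (a * + toℕ i)))) ⟨
    sum {k} (λ i → φ (toℕ (multiplyBy a i)))     ≡⟨ ∑-permute (λ i → φ (toℕ i)) π ⟨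
    sum {k} (λ i → φ (toℕ i))                    ≡⟨ ∑<-as-sum k φ ⟨
    ∑< k φ                                       ∎
    where
    open ≡-Reasoning
    ∣rem∣<k : ∀ i → ∣ rem i k ∣ ℕ.< k
    ∣rem∣<k i = proj₂ (nonNeg-< (proj₁ (rem-bounds i k)) (proj₂ (rem-bounds i k)))
    multiplyBy : ℤ → Fin k → Fin k
    multiplyBy c i = fromℕ< (∣rem∣<k (c * + toℕ i))
    inverse : ∀ c d → d * c ≡ 1ℤ + + k * t → ∀ i → multiplyBy d (multiplyBy c i) ≡ i
    inverse c d dc≡1+kt i = Fin.toℕ-injective (begin
      toℕ (multiplyBy d (multiplyBy c i))       ≡⟨ Fin.toℕ-fromℕ< _ ⟩
      ∣ rem (d * + toℕ (multiplyBy c i)) k ∣    ≡⟨ cong (λ j → ∣ rem (d * + j) k ∣) (Fin.toℕ-fromℕ< _) ⟩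
      ∣ rem (d * + ∣ rem (c * + toℕ i) k ∣) k ∣ ≡⟨ rem-inverse c d t dc≡1+kt (toℕ i) (Fin.toℕ<n i) ⟩
      toℕ i                                     ∎)
    π : Permutation k k
    π = permutation (multiplyBy a) (multiplyBy b)
          (inverse b a (trans (ℤ.*-comm a b) ba≡1+kt)) (inverse a b ba≡1+kt)

-- Lattice points under the line ks = hr

coprime⇒*≢* : ∀ {x y h : ℤ} {k} → x * h + y * + k ≡ 1ℤ → ∀ r t → 0 ℕ.< r → r ℕ.< k → h * + r ≢ + k * t
coprime⇒*≢* {x} {y} {h} {k} bezout r t 0<r r<k hr≡kt =
  ℤ.<-irrefl refl (ℤ.≤-<-trans (ℤ.i<j⇒suc[i]≤j 0<z) z<1)
  where
  open ≡-Reasoning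
  z = x * t + y * + r
  r≡kz : + r ≡ + k * z
  r≡kz = begin
    + r                           ≡⟨ sym (ℤ.*-identityˡ (+ r)) ⟩
    1ℤ * + r                      ≡⟨ cong (_* + r) (sym bezout) ⟩
    (x * h + y * + k) * + r       ≡⟨ expand x h y (+ k) (+ r) ⟩
    x * (h * + r) + y * + k * + r ≡⟨ cong (λ u → x * u + y * + k * + r) hr≡kt ⟩
    x * (+ k * t) + y * + k * + r ≡⟨ regroup x (+ k) t y (+ r) ⟩
    + k * z                       ∎
    where
    expand : ∀ x h y k r → (x * h + y * k) * r ≡ x * (h * r) + y * k * r
    expand = solve-∀
    regroup : ∀ x k t y r → x * (k * t) + y * k * r ≡ k * (x * t + y * r)
    regroup = solve-∀
  0<z : 0ℤ < z
  0<z = ℤ.*-cancelˡ-<-nonNeg (+ k) (subst₂ _<_ (sym (ℤ.*-zeroʳ (+ k))) r≡kz (+<+ 0<r))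
  z<1 : z < 1ℤ
  z<1 = ℤ.*-cancelˡ-<-nonNeg (+ k) (subst₂ _<_ r≡kz (sym (ℤ.*-identityʳ (+ k))) (+<+ r<k))

floorSum : ℤ → (k : ℕ) → .{{ℕ.NonZero k}} → ℤ
floorSum a k = ∑[ r < k ] ⌊ a * + r / k ⌋

floorSquareSum : ℤ → (k : ℕ) → .{{ℕ.NonZero k}} → ℤ
floorSquareSum a k = ∑[ r < k ] ⌊ a * + r / k ⌋ * ⌊ a * + r / k ⌋

weightedFloorSum : ℤ → (k : ℕ) → .{{ℕ.NonZero k}} → ℤ
weightedFloorSum a k = ∑[ r < k ] + r * ⌊ a * + r / k ⌋

0≤+*+ : ∀ m n → 0ℤ ≤ + m * + n
0≤+*+ m n = subst (0ℤ ≤_) (ℤ.pos-* m n) (+≤+ z≤n)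

module Lattice (h′ k′ : ℕ) (x y : ℤ) (bezout : x * + suc h′ + y * + suc k′ ≡ 1ℤ) where

  private
    h = suc h′
    k = suc k′

  f : ℕ → ℤ
  f r = ⌊ + h * + r / k ⌋

  g : ℕ → ℤ
  g s = ⌊ + k * + s / h ⌋

  f-bounds : ∀ r → r ℕ.< k → + ∣ f r ∣ ≡ f r × ∣ f r ∣ ℕ.< h
  f-bounds r r<k = uncurry nonNeg-< (floor-nonNeg-< (+ h * + r) k (+ h) (0≤+*+ h r)
    (subst (+ h * + r <_) (ℤ.*-comm (+ h) (+ k)) (ℤ.*-monoˡ-<-pos (+ h) (+<+ r<k))))

  g-bounds : ∀ s → s ℕ.< h → + ∣ g s ∣ ≡ g s × ∣ g s ∣ ℕ.< k
  g-bounds s s<h = uncurry nonNeg-< (floor-nonNeg-< (+ k * + s) h (+ k) (0≤+*+ k s)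
    (subst (+ k * + s <_) (ℤ.*-comm (+ k) (+ h)) (ℤ.*-monoˡ-<-pos (+ k) (+<+ s<h))))

  below? : ∀ r s → Dec (+ k * + s < + h * + r)
  below? r s = + k * + s ℤ.<? + h * + r

  row : ∀ (w : ℕ → ℤ) r → 0 ℕ.< r → r ℕ.< k → ∑[ s < h ] 𝟙 (below? r s) * w s ≡ ∑< (suc ∣ f r ∣) w
  row w r 0<r r<k = ∑-𝟙-prefix (below? r) ∣ f r ∣ ≤F⇒below F<⇒¬below w h (proj₂ (f-bounds r r<k))
    where
    ≤F⇒below : ∀ s → s ℕ.≤ ∣ f r ∣ → + k * + s < + h * + r
    ≤F⇒below s s≤F = ℤ.≤∧≢⇒< (floor-≤ (+ h * + r) k (+ s) (subst (+ s ≤_) (proj₁ (f-bounds r r<k)) (+≤+ s≤F)))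
                              (λ ks≡hr → coprime⇒*≢* {x} {y} {+ h} bezout r (+ s) 0<r r<k (sym ks≡hr))
    F<⇒¬below : ∀ s → ∣ f r ∣ ℕ.< s → ¬ (+ k * + s < + h * + r)
    F<⇒¬below s F<s = ℤ.<-asym (floor-< (+ h * + r) k (+ s) (subst (_< + s) (proj₁ (f-bounds r r<k)) (+<+ F<s)))

  row-zero : ∀ (w : ℕ → ℤ) → ∑[ s < h ] 𝟙 (below? 0 s) * w s ≡ 0ℤ
  row-zero w = go h
    where
    go : ∀ n → ∑[ s < n ] 𝟙 (below? 0 s) * w s ≡ 0ℤ
    go zero    = refl
    go (suc n) with below? 0 n
    ... | no _     = trans (ℤ.+-identityʳ (∑[ s < n ] 𝟙 (below? 0 s) * w s)) (go n)
    ... | yes ks<0 = ⊥-elim (ℤ.<⇒≱ ks<0 (subst (_≤ + k * + n) (sym (ℤ.*-zeroʳ (+ h))) (0≤+*+ k n)))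

  column : ∀ s → s ℕ.< h → ∑[ r < k ] 𝟙 (below? r s) ≡ + k - (1ℤ + g s)
  column s s<h = begin
    ∑[ r < k ] 𝟙 (below? r s)         ≡⟨ ∑-cong k (λ r _ → 𝟙-< (+ k * + s) (+ h * + r)) ⟩
    ∑[ r < k ] (1ℤ - 𝟙 (above? r))    ≡⟨ ∑-+ k (λ _ → 1ℤ) (λ r → - 𝟙 (above? r)) ⟩
    ∑< k (λ _ → 1ℤ) + (∑[ r < k ] - 𝟙 (above? r))
                                      ≡⟨ cong₂ _+_ (∑-1 k) (∑-neg k (λ r → 𝟙 (above? r))) ⟩
    + k - (∑[ r < k ] 𝟙 (above? r))   ≡⟨ cong (λ n → + k - n)
                                           (∑-𝟙-count above? ∣ g s ∣ ≤G⇒above G<⇒¬above k (proj₂ (g-bounds s s<h))) ⟩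
    + k - (1ℤ + + ∣ g s ∣)            ≡⟨ cong (λ n → + k - (1ℤ + n)) (proj₁ (g-bounds s s<h)) ⟩
    + k - (1ℤ + g s)                  ∎
    where
    open ≡-Reasoning
    above? : ∀ r → Dec (+ h * + r ≤ + k * + s)
    above? r = + h * + r ℤ.≤? + k * + s
    ≤G⇒above : ∀ r → r ℕ.≤ ∣ g s ∣ → + h * + r ≤ + k * + s
    ≤G⇒above r r≤G = floor-≤ (+ k * + s) h (+ r) (subst (+ r ≤_) (proj₁ (g-bounds s s<h)) (+≤+ r≤G))
    G<⇒¬above : ∀ r → ∣ g s ∣ ℕ.< r → ¬ (+ h * + r ≤ + k * + s)
    G<⇒¬above r G<r = ℤ.<⇒≱ (floor-< (+ k * + s) h (+ r) (subst (_< + r) (proj₁ (g-bounds s s<h)) (+<+ G<r)))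

  lattice-count : ∀ (w : ℕ → ℤ) → ∑[ r < k′ ] ∑< (suc ∣ f (suc r) ∣) w ≡ ∑[ s < h ] w s * (+ k - (1ℤ + g s))
  lattice-count w = begin
    ∑[ r < k′ ] ∑< (suc ∣ f (suc r) ∣) w         ≡⟨ ∑-cong k′ (λ r r<k′ → row w (suc r) (s≤s z≤n) (s≤s r<k′)) ⟨
    ∑[ r < k′ ] rowSum (suc r)                   ≡⟨ ∑-suc-zero k′ rowSum (row-zero w) ⟨
    ∑[ r < k ] ∑[ s < h ] 𝟙 (below? r s) * w s   ≡⟨ ∑-comm k h (λ r s → 𝟙 (below? r s) * w s) ⟩
    ∑[ s < h ] ∑[ r < k ] 𝟙 (below? r s) * w s   ≡⟨ ∑-cong h (λ s s<h → weigh s (column s s<h)) ⟩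
    ∑[ s < h ] w s * (+ k - (1ℤ + g s))          ∎
    where
    open ≡-Reasoning
    rowSum : ℕ → ℤ
    rowSum r = ∑[ s < h ] 𝟙 (below? r s) * w s
    weigh : ∀ s {c} → ∑[ r < k ] 𝟙 (below? r s) ≡ c → ∑[ r < k ] 𝟙 (below? r s) * w s ≡ w s * c
    weigh s refl = trans (∑-cong k (λ r _ → ℤ.*-comm _ (w s))) (∑-*ˡ k (w s) (λ r → 𝟙 (below? r s)))

  private
    f-zero : f 0 ≡ 0ℤ
    f-zero = floor-zero (+ h) k

  floorSum-symmetric : floorSum (+ h) k + floorSum (+ k) h ≡ (+ h - 1ℤ) * (+ k - 1ℤ)
  floorSum-symmetric = rearrange (+ k′) (+ h) (floorSum (+ h) k) (floorSum (+ k) h) (begin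
    + k′ + floorSum (+ h) k                       ≡⟨ cong₂ _+_ (∑-1 k′) (sym (∑-suc-zero k′ f f-zero)) ⟨
    ∑< k′ (λ _ → 1ℤ) + (∑[ r < k′ ] f (suc r))    ≡⟨ ∑-+ k′ (λ _ → 1ℤ) (λ r → f (suc r)) ⟨
    ∑[ r < k′ ] (1ℤ + f (suc r))                  ≡⟨ ∑-cong k′ (λ r r<k′ → row-length (suc r) (s≤s r<k′)) ⟨
    ∑[ r < k′ ] ∑< (suc ∣ f (suc r) ∣) (λ _ → 1ℤ) ≡⟨ lattice-count (λ _ → 1ℤ) ⟩
    ∑[ s < h ] 1ℤ * (+ k - (1ℤ + g s))            ≡⟨ ∑-cong h (λ s _ → split (+ k′) (g s)) ⟩
    ∑[ s < h ] (+ k′ + - g s)                     ≡⟨ ∑-+ h (λ _ → + k′) (λ s → - g s) ⟩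
    ∑< h (λ _ → + k′) + (∑[ s < h ] - g s)        ≡⟨ cong₂ _+_ (∑-const h (+ k′)) (∑-neg h g) ⟩
    + h * + k′ - floorSum (+ k) h                 ∎)
    where
    open ≡-Reasoning
    row-length : ∀ r → r ℕ.< k → ∑< (suc ∣ f r ∣) (λ _ → 1ℤ) ≡ 1ℤ + f r
    row-length r r<k = trans (∑-1 (suc ∣ f r ∣)) (cong (_+_ 1ℤ) (proj₁ (f-bounds r r<k)))
    split : ∀ k′ g → 1ℤ * (1ℤ + k′ - (1ℤ + g)) ≡ k′ + - g
    split = solve-∀
    rearrange : ∀ k′ h F F′ → k′ + F ≡ h * k′ - F′ → F + F′ ≡ (h - 1ℤ) * k′
    rearrange k′ h F F′ counted = begin
      F + F′                    ≡⟨ solve (k′ ∷ F ∷ F′ ∷ []) ⟩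
      (k′ + F) + F′ - k′        ≡⟨ cong (λ z → z + F′ - k′) counted ⟩
      (h * k′ - F′) + F′ - k′   ≡⟨ solve (k′ ∷ h ∷ F′ ∷ []) ⟩
      (h - 1ℤ) * k′             ∎

  floorSquareSum-lattice : floorSquareSum (+ h) k + + 2 * weightedFloorSum (+ k) h - floorSum (+ k) h
                         ≡ (+ k - 1ℤ) * ((+ h - 1ℤ) * (+ h - 1ℤ))
  floorSquareSum-lattice = rearrange (+ k′) (+ h) Q T F (begin
    Q - + k′                                                  ≡⟨ cong₂ _-_ (∑-suc-zero k′ (λ r → f r * f r) (cong (λ u → u * u) f-zero))
                                                                           (sym (∑-1 k′)) ⟩
    (∑[ r < k′ ] f (suc r) * f (suc r)) - ∑< k′ (λ _ → 1ℤ)     ≡⟨ cong (_+_ (∑[ r < k′ ] f (suc r) * f (suc r))) (∑-neg k′ (λ _ → 1ℤ)) ⟨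
    (∑[ r < k′ ] f (suc r) * f (suc r)) + (∑[ r < k′ ] - 1ℤ)  ≡⟨ ∑-+ k′ (λ r → f (suc r) * f (suc r)) (λ _ → - 1ℤ) ⟨
    ∑[ r < k′ ] (f (suc r) * f (suc r) - 1ℤ)                   ≡⟨ ∑-cong k′ (λ r r<k′ → row-odd (suc r) (s≤s r<k′)) ⟨
    ∑[ r < k′ ] ∑< (suc ∣ f (suc r) ∣) odd                     ≡⟨ lattice-count odd ⟩
    ∑[ s < h ] odd s * (+ k - (1ℤ + g s))                      ≡⟨ ∑-cong h (λ s _ → split (+ k′) (+ s) (g s)) ⟩
    ∑[ s < h ] (+ k′ * odd s + (- + 2) * (+ s * g s) + 1ℤ * g s)
                                                               ≡⟨ ∑-linear₃ h (+ k′) (- + 2) 1ℤ odd (λ s → + s * g s) g ⟩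
    + k′ * ∑< h odd + (- + 2) * T + 1ℤ * F                     ≡⟨ cong (λ z → + k′ * z + (- + 2) * T + 1ℤ * F) (∑-odd h) ⟩
    + k′ * (+ h * + h - + 2 * + h) + (- + 2) * T + 1ℤ * F      ∎)
    where
    open ≡-Reasoning
    Q = floorSquareSum (+ h) k
    T = weightedFloorSum (+ k) h
    F = floorSum (+ k) h
    odd : ℕ → ℤ
    odd s = + 2 * + s - 1ℤ
    square : ∀ f → (1ℤ + f) * (1ℤ + f) - + 2 * (1ℤ + f) ≡ f * f - 1ℤ
    square = solve-∀
    row-odd : ∀ r → r ℕ.< k → ∑< (suc ∣ f r ∣) odd ≡ f r * f r - 1ℤ
    row-odd r r<k = trans (∑-odd (suc ∣ f r ∣))
      (trans (cong (λ u → (1ℤ + u) * (1ℤ + u) - + 2 * (1ℤ + u)) (proj₁ (f-bounds r r<k))) (square (f r)))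
    split : ∀ k′ s g → (+ 2 * s - 1ℤ) * (1ℤ + k′ - (1ℤ + g)) ≡ k′ * (+ 2 * s - 1ℤ) + (- + 2) * (s * g) + 1ℤ * g
    split = solve-∀
    rearrange : ∀ k′ h Q T F → Q - k′ ≡ k′ * (h * h - + 2 * h) + (- + 2) * T + 1ℤ * F →
                Q + + 2 * T - F ≡ k′ * ((h - 1ℤ) * (h - 1ℤ))
    rearrange k′ h Q T F counted = begin
      Q + + 2 * T - F                                       ≡⟨ solve (k′ ∷ Q ∷ T ∷ F ∷ []) ⟩
      (Q - k′) + k′ + + 2 * T - F                           ≡⟨ cong (λ z → z + k′ + + 2 * T - F) counted ⟩
      k′ * (h * h - + 2 * h) + (- + 2) * T + 1ℤ * F + k′ + + 2 * T - F ≡⟨ solve (k′ ∷ h ∷ T ∷ F ∷ []) ⟩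
      k′ * ((h - 1ℤ) * (h - 1ℤ))                            ∎

-- Reciprocity for the numerators 2k² s(h, k)

dedekindNumerator : ℤ → (k : ℕ) → .{{ℕ.NonZero k}} → ℤ
dedekindNumerator a k = ∑[ r < k ] + r * (+ 2 * rem (a * + r) k - + k)

dedekindNumerator-expand : ∀ a k .{{_ : ℕ.NonZero k}} →
  dedekindNumerator a k ≡ + 2 * a * (∑[ r < k ] + r * + r) - + 2 * + k * weightedFloorSum a k - + k * (∑[ r < k ] + r)
dedekindNumerator-expand a k = begin
  dedekindNumerator a k
    ≡⟨ ∑-cong k (λ r _ → split a (+ k) (+ r) (f r)) ⟩
  ∑[ r < k ] (+ 2 * a * (+ r * + r) + (- (+ 2 * + k)) * (+ r * f r) + (- + k) * + r)
    ≡⟨ ∑-linear₃ k (+ 2 * a) (- (+ 2 * + k)) (- + k) (λ r → + r * + r) (λ r → + r * f r) (λ r → + r) ⟩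
  + 2 * a * P₂ + (- (+ 2 * + k)) * weightedFloorSum a k + (- + k) * P₁
    ≡⟨ collect (+ 2 * a) (+ k) P₂ (weightedFloorSum a k) P₁ ⟩
  + 2 * a * P₂ - + 2 * + k * weightedFloorSum a k - + k * P₁ ∎
  where
  open ≡-Reasoning
  f : ℕ → ℤ
  f r = ⌊ a * + r / k ⌋
  P₁ = ∑[ r < k ] + r
  P₂ = ∑[ r < k ] + r * + r
  split : ∀ a k r f → r * (+ 2 * (a * r - k * f) - k) ≡ + 2 * a * (r * r) + (- (+ 2 * k)) * (r * f) + (- k) * r
  split = solve-∀
  collect : ∀ a k P₂ T P₁ → a * P₂ + (- (+ 2 * k)) * T + (- k) * P₁ ≡ a * P₂ - + 2 * k * T - k * P₁
  collect = solve-∀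

residue-square-sum : ∀ a b t k .{{_ : ℕ.NonZero k}} → b * a ≡ 1ℤ + + k * t →
  a * a * (∑[ r < k ] + r * + r) - + 2 * a * + k * weightedFloorSum a k + + k * + k * floorSquareSum a k
    ≡ ∑[ r < k ] + r * + r
residue-square-sum a b t k ba≡1+kt = begin
  a * a * P₂ - + 2 * a * + k * T + + k * + k * Q
    ≡⟨ collect a (+ k) P₂ T Q ⟩
  a * a * P₂ + (- (+ 2 * a * + k)) * T + + k * + k * Q
    ≡⟨ ∑-linear₃ k (a * a) (- (+ 2 * a * + k)) (+ k * + k) (λ r → + r * + r) (λ r → + r * f r) (λ r → f r * f r) ⟨
  ∑[ r < k ] (a * a * (+ r * + r) + (- (+ 2 * a * + k)) * (+ r * f r) + + k * + k * (f r * f r))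
    ≡⟨ ∑-cong k (λ r _ → trans (square a (+ k) (+ r) (f r)) (cong (λ u → u * u) (sym (+∣rem∣≡rem (a * + r))))) ⟩
  ∑[ r < k ] (+ ∣ rem (a * + r) k ∣) * (+ ∣ rem (a * + r) k ∣)
    ≡⟨ ∑-rem-permute k a b t ba≡1+kt (λ j → + j * + j) ⟩
  P₂ ∎
  where
  open ≡-Reasoning
  f : ℕ → ℤ
  f r = ⌊ a * + r / k ⌋
  P₂ = ∑[ r < k ] + r * + r
  T = weightedFloorSum a k
  Q = floorSquareSum a k
  +∣rem∣≡rem : ∀ i → + ∣ rem i k ∣ ≡ rem i k
  +∣rem∣≡rem i = ℤ.0≤i⇒+∣i∣≡i (proj₁ (rem-bounds i k))
  collect : ∀ a k P₂ T Q → a * a * P₂ - + 2 * a * k * T + k * k * Q ≡ a * a * P₂ + (- (+ 2 * a * k)) * T + k * k * Q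
  collect = solve-∀
  square : ∀ a k r f → a * a * (r * r) + (- (+ 2 * a * k)) * (r * f) + k * k * (f * f) ≡ (a * r - k * f) * (a * r - k * f)
  square = solve-∀

-- N, N′, T, T′, Q, F′ are N(h, k), N(k, h), Σ r f(r), Σ s g(s), Σ f(r)², Σ g(s);
-- P₁, P₂ (resp. P₁′, P₂′) are the sums of i and i² over i < k (resp. i < h).
module ReciprocityAlgebra
  (h k N N′ T T′ Q F′ P₁ P₂ P₁′ P₂′ : ℤ)
  (N-expand   : N ≡ + 2 * h * P₂ - + 2 * k * T - k * P₁)
  (N′-expand  : N′ ≡ + 2 * k * P₂′ - + 2 * h * T′ - h * P₁′)
  (residues   : h * h * P₂ - + 2 * h * k * T + k * k * Q ≡ P₂)
  (lattice    : Q + + 2 * T′ - F′ ≡ (k - 1ℤ) * ((h - 1ℤ) * (h - 1ℤ)))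
  (∑naturals  : + 2 * P₁ ≡ k * (k - 1ℤ))
  (∑squares   : + 6 * P₂ ≡ (k - 1ℤ) * k * (+ 2 * k - 1ℤ))
  (∑naturals′ : + 2 * P₁′ ≡ h * (h - 1ℤ))
  (∑squares′  : + 6 * P₂′ ≡ (h - 1ℤ) * h * (+ 2 * h - 1ℤ))
  where

  open ≡-Reasoning

  h*N+k²*Q : h * N + k * k * Q ≡ (h * h + 1ℤ) * P₂ - h * k * P₁
  h*N+k²*Q = begin
    h * N + k * k * Q                                                      ≡⟨ cong (λ n → h * n + k * k * Q) N-expand ⟩
    h * (+ 2 * h * P₂ - + 2 * k * T - k * P₁) + k * k * Q                 ≡⟨ solve (h ∷ k ∷ T ∷ Q ∷ P₁ ∷ P₂ ∷ []) ⟩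
    (h * h * P₂ - + 2 * h * k * T + k * k * Q) + h * h * P₂ - h * k * P₁ ≡⟨ cong (λ z → z + h * h * P₂ - h * k * P₁) residues ⟩
    P₂ + h * h * P₂ - h * k * P₁                                           ≡⟨ solve (h ∷ k ∷ P₁ ∷ P₂ ∷ []) ⟩
    (h * h + 1ℤ) * P₂ - h * k * P₁                                         ∎

  k*N′+2hk*T′ : k * N′ + + 2 * h * k * T′ ≡ + 2 * k * k * P₂′ - h * k * P₁′
  k*N′+2hk*T′ = begin
    k * N′ + + 2 * h * k * T′                                        ≡⟨ cong (λ n → k * n + + 2 * h * k * T′) N′-expand ⟩
    k * (+ 2 * k * P₂′ - + 2 * h * T′ - h * P₁′) + + 2 * h * k * T′ ≡⟨ solve (h ∷ k ∷ T′ ∷ P₁′ ∷ P₂′ ∷ []) ⟩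
    + 2 * k * k * P₂′ - h * k * P₁′                                  ∎

  one-sided : + 6 * (h * h * N + k * k * N′ + h * k * k * F′)
            ≡ h * k * (h * h + 1ℤ + + 3 * k - + 2 * k * k - + 6 * h * k + + 3 * h * k * k)
  one-sided = begin
    + 6 * (h * h * N + k * k * N′ + h * k * k * F′)
      ≡⟨ solve (h ∷ k ∷ N ∷ N′ ∷ T′ ∷ Q ∷ F′ ∷ []) ⟩
    + 6 * h * (h * N + k * k * Q) - + 6 * h * k * k * (Q + + 2 * T′ - F′) + + 6 * k * (k * N′ + + 2 * h * k * T′)
      ≡⟨ cong₂ (λ u v → + 6 * h * u - + 6 * h * k * k * v + + 6 * k * (k * N′ + + 2 * h * k * T′)) h*N+k²*Q lattice ⟩
    + 6 * h * ((h * h + 1ℤ) * P₂ - h * k * P₁) - + 6 * h * k * k * ((k - 1ℤ) * ((h - 1ℤ) * (h - 1ℤ)))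
      + + 6 * k * (k * N′ + + 2 * h * k * T′)
      ≡⟨ cong (λ u → + 6 * h * ((h * h + 1ℤ) * P₂ - h * k * P₁) - + 6 * h * k * k * ((k - 1ℤ) * ((h - 1ℤ) * (h - 1ℤ)))
                     + + 6 * k * u) k*N′+2hk*T′ ⟩
    + 6 * h * ((h * h + 1ℤ) * P₂ - h * k * P₁) - + 6 * h * k * k * ((k - 1ℤ) * ((h - 1ℤ) * (h - 1ℤ)))
      + + 6 * k * (+ 2 * k * k * P₂′ - h * k * P₁′)
      ≡⟨ solve (h ∷ k ∷ P₁ ∷ P₂ ∷ P₁′ ∷ P₂′ ∷ []) ⟩
    h * (h * h + 1ℤ) * (+ 6 * P₂) - + 3 * h * h * k * (+ 2 * P₁) - + 6 * h * k * k * ((k - 1ℤ) * ((h - 1ℤ) * (h - 1ℤ)))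
      + + 2 * k * k * k * (+ 6 * P₂′) - + 3 * h * k * k * (+ 2 * P₁′)
      ≡⟨ cong₂ (λ u v → h * (h * h + 1ℤ) * u - + 3 * h * h * k * v - + 6 * h * k * k * ((k - 1ℤ) * ((h - 1ℤ) * (h - 1ℤ)))
                       + + 2 * k * k * k * (+ 6 * P₂′) - + 3 * h * k * k * (+ 2 * P₁′)) ∑squares ∑naturals ⟩
    h * (h * h + 1ℤ) * ((k - 1ℤ) * k * (+ 2 * k - 1ℤ)) - + 3 * h * h * k * (k * (k - 1ℤ))
      - + 6 * h * k * k * ((k - 1ℤ) * ((h - 1ℤ) * (h - 1ℤ))) + + 2 * k * k * k * (+ 6 * P₂′) - + 3 * h * k * k * (+ 2 * P₁′)
      ≡⟨ cong₂ (λ u v → h * (h * h + 1ℤ) * ((k - 1ℤ) * k * (+ 2 * k - 1ℤ)) - + 3 * h * h * k * (k * (k - 1ℤ))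
                       - + 6 * h * k * k * ((k - 1ℤ) * ((h - 1ℤ) * (h - 1ℤ))) + + 2 * k * k * k * u - + 3 * h * k * k * v)
               ∑squares′ ∑naturals′ ⟩
    h * (h * h + 1ℤ) * ((k - 1ℤ) * k * (+ 2 * k - 1ℤ)) - + 3 * h * h * k * (k * (k - 1ℤ))
      - + 6 * h * k * k * ((k - 1ℤ) * ((h - 1ℤ) * (h - 1ℤ))) + + 2 * k * k * k * ((h - 1ℤ) * h * (+ 2 * h - 1ℤ))
      - + 3 * h * k * k * (h * (h - 1ℤ))
      ≡⟨ solve (h ∷ k ∷ []) ⟩
    h * k * (h * h + 1ℤ + + 3 * k - + 2 * k * k - + 6 * h * k + + 3 * h * k * k) ∎

bezout⇒inverse : ∀ {x h y k} → x * h + y * k ≡ 1ℤ → x * h ≡ 1ℤ + k * (- y)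
bezout⇒inverse {x} {h} {y} {k} bezout = begin
  x * h                     ≡⟨ solve (x ∷ h ∷ y ∷ k ∷ []) ⟩
  x * h + y * k + k * (- y) ≡⟨ cong (_+ k * (- y)) bezout ⟩
  1ℤ + k * (- y)            ∎
  where open ≡-Reasoning

dedekindNumerator-one-sided : ∀ h′ k′ x y → x * + suc h′ + y * + suc k′ ≡ 1ℤ →
  let h = + suc h′ ; k = + suc k′ in
  + 6 * (h * h * dedekindNumerator h (suc k′) + k * k * dedekindNumerator k (suc h′) + h * k * k * floorSum k (suc h′))
    ≡ h * k * (h * h + 1ℤ + + 3 * k - + 2 * k * k - + 6 * h * k + + 3 * h * k * k)
dedekindNumerator-one-sided h′ k′ x y bezout = ReciprocityAlgebra.one-sided (+ suc h′) (+ suc k′) _ _ _ _ _ _ _ _ _ _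
  (dedekindNumerator-expand (+ suc h′) (suc k′)) (dedekindNumerator-expand (+ suc k′) (suc h′))
  (residue-square-sum (+ suc h′) x (- y) (suc k′) (bezout⇒inverse {x} {+ suc h′} {y} {+ suc k′} bezout))
  (Lattice.floorSquareSum-lattice h′ k′ x y bezout)
  (∑-naturals (suc k′)) (∑-squares (suc k′)) (∑-naturals (suc h′)) (∑-squares (suc h′))

-- Weighting the two orientations by h and k leaves the floor sums only as F + F′.
reciprocity-from-one-sided : ∀ h k N N′ F F′ .{{_ : ℤ.NonZero (h + k)}} →
  + 6 * (h * h * N + k * k * N′ + h * k * k * F′) ≡ h * k * (h * h + 1ℤ + + 3 * k - + 2 * k * k - + 6 * h * k + + 3 * h * k * k) →
  + 6 * (k * k * N′ + h * h * N + k * h * h * F) ≡ k * h * (k * k + 1ℤ + + 3 * h - + 2 * h * h - + 6 * k * h + + 3 * k * h * h) →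
  F + F′ ≡ (h - 1ℤ) * (k - 1ℤ) →
  + 6 * (h * h) * N + + 6 * (k * k) * N′ ≡ h * k * (h * h + k * k + 1ℤ) - + 3 * (h * h) * (k * k)
reciprocity-from-one-sided h k N N′ F F′ one-sided one-sided′ F+F′ = ℤ.*-cancelˡ-≡ (h + k) _ _ (begin
  (h + k) * (+ 6 * (h * h) * N + + 6 * (k * k) * N′)
    ≡⟨ solve (h ∷ k ∷ N ∷ N′ ∷ F ∷ F′ ∷ []) ⟩
  h * (+ 6 * (h * h * N + k * k * N′ + h * k * k * F′)) + k * (+ 6 * (k * k * N′ + h * h * N + k * h * h * F))
    - + 6 * h * h * k * k * (F + F′)
    ≡⟨ cong₂ (λ u v → h * u + k * v - + 6 * h * h * k * k * (F + F′)) one-sided one-sided′ ⟩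
  h * (h * k * (h * h + 1ℤ + + 3 * k - + 2 * k * k - + 6 * h * k + + 3 * h * k * k))
    + k * (k * h * (k * k + 1ℤ + + 3 * h - + 2 * h * h - + 6 * k * h + + 3 * k * h * h)) - + 6 * h * h * k * k * (F + F′)
    ≡⟨ cong (λ u → h * (h * k * (h * h + 1ℤ + + 3 * k - + 2 * k * k - + 6 * h * k + + 3 * h * k * k))
                 + k * (k * h * (k * k + 1ℤ + + 3 * h - + 2 * h * h - + 6 * k * h + + 3 * k * h * h)) - + 6 * h * h * k * k * u)
            F+F′ ⟩
  h * (h * k * (h * h + 1ℤ + + 3 * k - + 2 * k * k - + 6 * h * k + + 3 * h * k * k))
    + k * (k * h * (k * k + 1ℤ + + 3 * h - + 2 * h * h - + 6 * k * h + + 3 * k * h * h)) - + 6 * h * h * k * k * ((h - 1ℤ) * (k - 1ℤ))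
    ≡⟨ solve (h ∷ k ∷ []) ⟩
  (h + k) * (h * k * (h * h + k * k + 1ℤ) - + 3 * (h * h) * (k * k)) ∎)
  where open ≡-Reasoning

dedekindNumerator-reciprocity : ∀ h′ k′ x y → x * + suc h′ + y * + suc k′ ≡ 1ℤ →
  let h = suc h′ ; k = suc k′ in
  + 6 * (+ h * + h) * dedekindNumerator (+ h) k + + 6 * (+ k * + k) * dedekindNumerator (+ k) h
    ≡ + h * + k * (+ h * + h + + k * + k + 1ℤ) - + 3 * (+ h * + h) * (+ k * + k)
dedekindNumerator-reciprocity h′ k′ x y bezout =
  reciprocity-from-one-sided (+ suc h′) (+ suc k′)
    (dedekindNumerator (+ suc h′) (suc k′)) (dedekindNumerator (+ suc k′) (suc h′))
    (floorSum (+ suc h′) (suc k′)) (floorSum (+ suc k′) (suc h′))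
    (dedekindNumerator-one-sided h′ k′ x y bezout)
    (dedekindNumerator-one-sided k′ h′ y x (trans (ℤ.+-comm (y * + suc k′) (x * + suc h′)) bezout))
    (Lattice.floorSum-symmetric h′ k′ x y bezout)

-- Dedekind sums

ℚ-ring : AlmostCommutativeRing 0ℓ 0ℓ
ℚ-ring = fromCommutativeRing ℚ.+-*-commutativeRing λ p → case p ℚ.≟ ℚ.0ℚ of λ where
  (yes p≡0) → just (sym p≡0)
  (no _)    → nothing

ι : ℤ → ℚ
ι i = i / 1

recip : (n : ℕ) → .{{ℕ.NonZero n}} → ℚ
recip n = + 1 / n

private
  toℚᵘ-/ : ∀ i n → ℚ.toℚᵘ (i / suc n) ℚᵘ.≃ ℚᵘ.mkℚᵘ i n
  toℚᵘ-/ i n = ℚ.toℚᵘ-fromℚᵘ (ℚᵘ.mkℚᵘ i n)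

ι-+ : ∀ a b → ι (a + b) ≡ ι a ℚ.+ ι b
ι-+ a b = ℚ.toℚᵘ-injective (ℚᵘ.≃-trans (toℚᵘ-/ (a + b) 0) (ℚᵘ.≃-sym (ℚᵘ.≃-trans (ℚ.toℚᵘ-homo-+ (ι a) (ι b))
            (ℚᵘ.≃-trans (ℚᵘ.+-cong (toℚᵘ-/ a 0) (toℚᵘ-/ b 0)) (ℚᵘ.*≡* (cross-multiply a b))))))
  where
  cross-multiply : ∀ a b → (a * 1ℤ + b * 1ℤ) * 1ℤ ≡ (a + b) * 1ℤ
  cross-multiply = solve-∀

ι-* : ∀ a b → ι (a * b) ≡ ι a ℚ.* ι b
ι-* a b = ℚ.toℚᵘ-injective (ℚᵘ.≃-trans (toℚᵘ-/ (a * b) 0) (ℚᵘ.≃-sym (ℚᵘ.≃-trans (ℚ.toℚᵘ-homo-* (ι a) (ι b))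
            (ℚᵘ.*-cong (toℚᵘ-/ a 0) (toℚᵘ-/ b 0)))))

ι-neg : ∀ a → ι (- a) ≡ ℚ.- ι a
ι-neg a = ℚ.toℚᵘ-injective (ℚᵘ.≃-trans (toℚᵘ-/ (- a) 0)
            (ℚᵘ.≃-sym (ℚᵘ.≃-trans (ℚ.toℚᵘ-homo‿- (ι a)) (ℚᵘ.-‿cong (toℚᵘ-/ a 0)))))

ι-- : ∀ a b → ι (a - b) ≡ ι a ℚ.- ι b
ι-- a b = trans (ι-+ a (- b)) (cong (ι a ℚ.+_) (ι-neg b))

/-as-* : ∀ i n .{{_ : ℕ.NonZero n}} → i / n ≡ ι i ℚ.* recip n
/-as-* i (suc n) = ℚ.toℚᵘ-injective (ℚᵘ.≃-trans (toℚᵘ-/ i n) (ℚᵘ.≃-sym (ℚᵘ.≃-trans (ℚ.toℚᵘ-homo-* (ι i) (recip (suc n)))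
            (ℚᵘ.≃-trans (ℚᵘ.*-cong (toℚᵘ-/ i 0) (toℚᵘ-/ (+ 1) n)) (ℚᵘ.*≡* (cross-multiply i (+ suc n)))))))
  where
  cross-multiply : ∀ i n → i * 1ℤ * n ≡ i * (1ℤ * n)
  cross-multiply = solve-∀

recip-* : ∀ m n → recip (suc m ℕ.* suc n) ≡ recip (suc m) ℚ.* recip (suc n)
recip-* m n = ℚ.toℚᵘ-injective (ℚᵘ.≃-trans (toℚᵘ-/ (+ 1) (n ℕ.+ m ℕ.* suc n)) (ℚᵘ.≃-sym
            (ℚᵘ.≃-trans (ℚ.toℚᵘ-homo-* (recip (suc m)) (recip (suc n))) (ℚᵘ.*-cong (toℚᵘ-/ (+ 1) m) (toℚᵘ-/ (+ 1) n)))))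

ι-*-recip : ∀ n .{{_ : ℕ.NonZero n}} → ι (+ n) ℚ.* recip n ≡ ℚ.1ℚ
ι-*-recip (suc n) = trans (sym (/-as-* (+ suc n) (suc n))) (ℚ.toℚᵘ-injective (ℚᵘ.≃-trans (toℚᵘ-/ (+ suc n) n)
            (ℚᵘ.*≡* (trans (ℤ.*-identityʳ (+ suc n)) (sym (ℤ.*-identityˡ (+ suc n)))))))

sumFrom1-as-∑ : ∀ n (F : ℕ → ℚ) (G : ℕ → ℤ) w → (∀ j → F (suc j) ≡ ι (G (suc j)) ℚ.* w) →
                sumFrom1 (suc n) F ≡ ι (∑[ j < n ] G (suc j)) ℚ.* w
sumFrom1-as-∑ zero    F G w _  = sym (ℚ.*-zeroˡ w)
sumFrom1-as-∑ (suc n) F G w F≡ = begin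
  sumFrom1 (suc n) F ℚ.+ F (suc n)                         ≡⟨ cong₂ ℚ._+_ (sumFrom1-as-∑ n F G w F≡) (F≡ n) ⟩
  ι (∑[ j < n ] G (suc j)) ℚ.* w ℚ.+ ι (G (suc n)) ℚ.* w   ≡⟨ ℚ.*-distribʳ-+ w (ι (∑[ j < n ] G (suc j))) (ι (G (suc n))) ⟨
  (ι (∑[ j < n ] G (suc j)) ℚ.+ ι (G (suc n))) ℚ.* w       ≡⟨ cong (ℚ._* w) (ι-+ (∑[ j < n ] G (suc j)) (G (suc n))) ⟨
  ι (∑[ j < suc n ] G (suc j)) ℚ.* w                       ∎
  where open ≡-Reasoning

dedekind-term-algebra : ∀ r A f K u → K ℚ.* u ≡ ℚ.1ℚ →
  r ℚ.* u ℚ.* (A ℚ.* u ℚ.- f ℚ.- ½) ≡ r ℚ.* (ι (+ 2) ℚ.* (A ℚ.- K ℚ.* f) ℚ.- K) ℚ.* (u ℚ.* u ℚ.* ½)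
dedekind-term-algebra r A f K u Ku≡1 = sym (begin
  r ℚ.* (ι (+ 2) ℚ.* (A ℚ.- K ℚ.* f) ℚ.- K) ℚ.* (u ℚ.* u ℚ.* ½)
    ≡⟨ ℚ-Solver.solve (r ∷ A ∷ f ∷ K ∷ u ∷ []) ℚ-ring ⟩
  r ℚ.* u ℚ.* (A ℚ.* u ℚ.- (K ℚ.* u) ℚ.* f ℚ.- (K ℚ.* u) ℚ.* ½)
    ≡⟨ cong (λ z → r ℚ.* u ℚ.* (A ℚ.* u ℚ.- z ℚ.* f ℚ.- z ℚ.* ½)) Ku≡1 ⟩
  r ℚ.* u ℚ.* (A ℚ.* u ℚ.- ℚ.1ℚ ℚ.* f ℚ.- ℚ.1ℚ ℚ.* ½)
    ≡⟨ ℚ-Solver.solve (r ∷ A ∷ f ∷ u ∷ []) ℚ-ring ⟩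
  r ℚ.* u ℚ.* (A ℚ.* u ℚ.- f ℚ.- ½) ∎)
  where open ≡-Reasoning

dedekind-as-numerator : ∀ a k .{{_ : ℕ.NonZero k}} →
                        dedekind a k ≡ ι (dedekindNumerator a k) ℚ.* (recip k ℚ.* recip k ℚ.* ½)
dedekind-as-numerator a (suc k′) =
  trans (sumFrom1-as-∑ k′ _ G w (λ j → term (suc j))) (cong (λ n → ι n ℚ.* w) (sym (∑-suc-zero k′ G refl)))
  where
  open ≡-Reasoning
  k = suc k′
  u = recip k
  w = u ℚ.* u ℚ.* ½
  G : ℕ → ℤ
  G r = + r * (+ 2 * rem (a * + r) k - + k)
  term : ∀ r → (+ r / k) ℚ.* ((a * + r) / k ℚ.- ι ⌊ a * + r / k ⌋ ℚ.- ½) ≡ ι (G r) ℚ.* w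
  term r = begin
    (+ r / k) ℚ.* ((a * + r) / k ℚ.- ι q ℚ.- ½)
      ≡⟨ cong₂ (λ x y → x ℚ.* (y ℚ.- ι q ℚ.- ½)) (/-as-* (+ r) k) (/-as-* (a * + r) k) ⟩
    ι (+ r) ℚ.* u ℚ.* (ι (a * + r) ℚ.* u ℚ.- ι q ℚ.- ½)
      ≡⟨ dedekind-term-algebra (ι (+ r)) (ι (a * + r)) (ι q) (ι (+ k)) u (ι-*-recip k) ⟩
    ι (+ r) ℚ.* (ι (+ 2) ℚ.* (ι (a * + r) ℚ.- ι (+ k) ℚ.* ι q) ℚ.- ι (+ k)) ℚ.* w
      ≡⟨ cong (ℚ._* w) ι-G ⟨
    ι (G r) ℚ.* w ∎
    where
    q = ⌊ a * + r / k ⌋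
    ι-G : ι (G r) ≡ ι (+ r) ℚ.* (ι (+ 2) ℚ.* (ι (a * + r) ℚ.- ι (+ k) ℚ.* ι q) ℚ.- ι (+ k))
    ι-G = trans (ι-* (+ r) (+ 2 * (a * + r - + k * q) - + k)) (cong (ι (+ r) ℚ.*_)
            (trans (ι-- (+ 2 * (a * + r - + k * q)) (+ k)) (cong (ℚ._- ι (+ k))
              (trans (ι-* (+ 2) (a * + r - + k * q)) (cong (ι (+ 2) ℚ.*_)
                (trans (ι-- (a * + r) (+ k * q)) (cong (ℚ._-_ (ι (a * + r))) (ι-* (+ k) q))))))))

dedekindNumerator-neg : ∀ {x y} a k .{{_ : ℕ.NonZero k}} → x * a + y * + k ≡ 1ℤ →
                        dedekindNumerator (- a) k ≡ - dedekindNumerator a k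
dedekindNumerator-neg {x} {y} a k bezout = trans (∑-cong k term) (∑-neg k (λ r → + r * (+ 2 * rem (a * + r) k - + k)))
  where
  term : ∀ r → r ℕ.< k → + r * (+ 2 * rem (- a * + r) k - + k) ≡ - (+ r * (+ 2 * rem (a * + r) k - + k))
  term zero    _   = refl
  term (suc r) r<k = begin
    + suc r * (+ 2 * rem (- a * + suc r) k - + k)        ≡⟨ cong (λ i → + suc r * (+ 2 * rem i k - + k)) (ℤ.neg-distribˡ-* a (+ suc r)) ⟨
    + suc r * (+ 2 * rem (- (a * + suc r)) k - + k)      ≡⟨ cong (λ m → + suc r * (+ 2 * m - + k)) (rem-neg (a * + suc r) k rem≢0) ⟩
    + suc r * (+ 2 * (+ k - rem (a * + suc r) k) - + k)  ≡⟨ reflect (+ suc r) (+ k) (rem (a * + suc r) k) ⟩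
    - (+ suc r * (+ 2 * rem (a * + suc r) k - + k))      ∎
    where
    open ≡-Reasoning
    reflect : ∀ r k m → r * (+ 2 * (k - m) - k) ≡ - (r * (+ 2 * m - k))
    reflect = solve-∀
    restore : ∀ i j → i ≡ i - j + j
    restore = solve-∀
    rem≢0 : rem (a * + suc r) k ≢ 0ℤ
    rem≢0 rem≡0 = coprime⇒*≢* {x} {y} {a} bezout (suc r) ⌊ a * + suc r / k ⌋ (s≤s z≤n) r<k
      (trans (restore (a * + suc r) (+ k * ⌊ a * + suc r / k ⌋))
             (trans (cong (_+ + k * ⌊ a * + suc r / k ⌋) rem≡0) (ℤ.+-identityˡ _)))

dedekind-neg : ∀ {x y} a k .{{_ : ℕ.NonZero k}} → x * a + y * + k ≡ 1ℤ → dedekind (- a) k ≡ ℚ.- dedekind a k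
dedekind-neg {x} {y} a k bezout = begin
  dedekind (- a) k                       ≡⟨ dedekind-as-numerator (- a) k ⟩
  ι (dedekindNumerator (- a) k) ℚ.* w    ≡⟨ cong (λ n → ι n ℚ.* w) (dedekindNumerator-neg {x} {y} a k bezout) ⟩
  ι (- dedekindNumerator a k) ℚ.* w      ≡⟨ cong (ℚ._* w) (ι-neg (dedekindNumerator a k)) ⟩
  ℚ.- ι (dedekindNumerator a k) ℚ.* w    ≡⟨ ℚ.neg-distribˡ-* (ι (dedekindNumerator a k)) w ⟨
  ℚ.- (ι (dedekindNumerator a k) ℚ.* w)  ≡⟨ cong ℚ.-_ (dedekind-as-numerator a k) ⟨
  ℚ.- dedekind a k                       ∎
  where
  open ≡-Reasoning
  w = recip k ℚ.* recip k ℚ.* ½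

reciprocity-algebra : ∀ H K u v N₁ N₂ → H ℚ.* u ≡ ℚ.1ℚ → K ℚ.* v ≡ ℚ.1ℚ →
  ι (+ 6) ℚ.* (H ℚ.* H) ℚ.* N₁ ℚ.+ ι (+ 6) ℚ.* (K ℚ.* K) ℚ.* N₂
    ≡ H ℚ.* K ℚ.* (H ℚ.* H ℚ.+ K ℚ.* K ℚ.+ ℚ.1ℚ) ℚ.- ι (+ 3) ℚ.* (H ℚ.* H) ℚ.* (K ℚ.* K) →
  N₁ ℚ.* (v ℚ.* v ℚ.* ½) ℚ.+ N₂ ℚ.* (u ℚ.* u ℚ.* ½) ≡ (H ℚ.* v ℚ.+ K ℚ.* u ℚ.+ u ℚ.* v) ℚ.* recip 12 ℚ.- recip 4
reciprocity-algebra H K u v N₁ N₂ Hu≡1 Kv≡1 integral = begin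
  N₁ ℚ.* (v ℚ.* v ℚ.* ½) ℚ.+ N₂ ℚ.* (u ℚ.* u ℚ.* ½)
    ≡⟨ ℚ-Solver.solve (u ∷ v ∷ N₁ ∷ N₂ ∷ []) ℚ-ring ⟩
  N₁ ℚ.* (v ℚ.* v ℚ.* ½) ℚ.* (ℚ.1ℚ ℚ.* ℚ.1ℚ) ℚ.+ N₂ ℚ.* (u ℚ.* u ℚ.* ½) ℚ.* (ℚ.1ℚ ℚ.* ℚ.1ℚ)
    ≡⟨ cong₂ (λ p q → N₁ ℚ.* (v ℚ.* v ℚ.* ½) ℚ.* (p ℚ.* p) ℚ.+ N₂ ℚ.* (u ℚ.* u ℚ.* ½) ℚ.* (q ℚ.* q)) Hu≡1 Kv≡1 ⟨
  N₁ ℚ.* (v ℚ.* v ℚ.* ½) ℚ.* ((H ℚ.* u) ℚ.* (H ℚ.* u))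
    ℚ.+ N₂ ℚ.* (u ℚ.* u ℚ.* ½) ℚ.* ((K ℚ.* v) ℚ.* (K ℚ.* v))
    ≡⟨ ℚ-Solver.solve (H ∷ K ∷ u ∷ v ∷ N₁ ∷ N₂ ∷ []) ℚ-ring ⟩
  (ι (+ 6) ℚ.* (H ℚ.* H) ℚ.* N₁ ℚ.+ ι (+ 6) ℚ.* (K ℚ.* K) ℚ.* N₂) ℚ.* (u ℚ.* u ℚ.* v ℚ.* v ℚ.* recip 12)
    ≡⟨ cong (ℚ._* (u ℚ.* u ℚ.* v ℚ.* v ℚ.* recip 12)) integral ⟩
  (H ℚ.* K ℚ.* (H ℚ.* H ℚ.+ K ℚ.* K ℚ.+ ℚ.1ℚ) ℚ.- ι (+ 3) ℚ.* (H ℚ.* H) ℚ.* (K ℚ.* K))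
    ℚ.* (u ℚ.* u ℚ.* v ℚ.* v ℚ.* recip 12)
    ≡⟨ ℚ-Solver.solve (H ∷ K ∷ u ∷ v ∷ []) ℚ-ring ⟩
  ((H ℚ.* u) ℚ.* (H ℚ.* u) ℚ.* (K ℚ.* v) ℚ.* (H ℚ.* v) ℚ.+ (K ℚ.* v) ℚ.* (K ℚ.* v) ℚ.* (H ℚ.* u) ℚ.* (K ℚ.* u)
     ℚ.+ (H ℚ.* u) ℚ.* (K ℚ.* v) ℚ.* (u ℚ.* v)) ℚ.* recip 12
    ℚ.- ι (+ 3) ℚ.* ((H ℚ.* u) ℚ.* (H ℚ.* u) ℚ.* (K ℚ.* v) ℚ.* (K ℚ.* v)) ℚ.* recip 12
    ≡⟨ cong₂ (λ p q → (p ℚ.* p ℚ.* q ℚ.* (H ℚ.* v) ℚ.+ q ℚ.* q ℚ.* p ℚ.* (K ℚ.* u) ℚ.+ p ℚ.* q ℚ.* (u ℚ.* v)) ℚ.* recip 12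
                      ℚ.- ι (+ 3) ℚ.* (p ℚ.* p ℚ.* q ℚ.* q) ℚ.* recip 12) Hu≡1 Kv≡1 ⟩
  (ℚ.1ℚ ℚ.* ℚ.1ℚ ℚ.* ℚ.1ℚ ℚ.* (H ℚ.* v) ℚ.+ ℚ.1ℚ ℚ.* ℚ.1ℚ ℚ.* ℚ.1ℚ ℚ.* (K ℚ.* u)
     ℚ.+ ℚ.1ℚ ℚ.* ℚ.1ℚ ℚ.* (u ℚ.* v)) ℚ.* recip 12
    ℚ.- ι (+ 3) ℚ.* (ℚ.1ℚ ℚ.* ℚ.1ℚ ℚ.* ℚ.1ℚ ℚ.* ℚ.1ℚ) ℚ.* recip 12
    ≡⟨ ℚ-Solver.solve (H ∷ K ∷ u ∷ v ∷ []) ℚ-ring ⟩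
  (H ℚ.* v ℚ.+ K ℚ.* u ℚ.+ u ℚ.* v) ℚ.* recip 12 ℚ.- recip 4 ∎
  where open ≡-Reasoning

dedekind-reciprocity : ∀ h′ k′ x y → x * + suc h′ + y * + suc k′ ≡ 1ℤ →
  let h = suc h′ ; k = suc k′ in
  dedekind (+ h) k ℚ.+ dedekind (+ k) h
    ≡ (ι (+ h) ℚ.* recip k ℚ.+ ι (+ k) ℚ.* recip h ℚ.+ recip h ℚ.* recip k) ℚ.* recip 12 ℚ.- recip 4
dedekind-reciprocity h′ k′ x y bezout = begin
  dedekind H k ℚ.+ dedekind K h
    ≡⟨ cong₂ ℚ._+_ (dedekind-as-numerator H k) (dedekind-as-numerator K h) ⟩
  ι N₁ ℚ.* (recip k ℚ.* recip k ℚ.* ½) ℚ.+ ι N₂ ℚ.* (recip h ℚ.* recip h ℚ.* ½)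
    ≡⟨ reciprocity-algebra (ι H) (ι K) (recip h) (recip k) (ι N₁) (ι N₂) (ι-*-recip h) (ι-*-recip k) lifted ⟩
  (ι H ℚ.* recip k ℚ.+ ι K ℚ.* recip h ℚ.+ recip h ℚ.* recip k) ℚ.* recip 12 ℚ.- recip 4 ∎
  where
  open ≡-Reasoning
  h = suc h′
  k = suc k′
  H = + h
  K = + k
  N₁ = dedekindNumerator H k
  N₂ = dedekindNumerator K h
  ι-6a²n : ∀ a n → ι (+ 6 * (a * a) * n) ≡ ι (+ 6) ℚ.* (ι a ℚ.* ι a) ℚ.* ι n
  ι-6a²n a n = trans (ι-* (+ 6 * (a * a)) n) (cong (ℚ._* ι n) (trans (ι-* (+ 6) (a * a)) (cong (ι (+ 6) ℚ.*_) (ι-* a a))))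
  lifted : ι (+ 6) ℚ.* (ι H ℚ.* ι H) ℚ.* ι N₁ ℚ.+ ι (+ 6) ℚ.* (ι K ℚ.* ι K) ℚ.* ι N₂
         ≡ ι H ℚ.* ι K ℚ.* (ι H ℚ.* ι H ℚ.+ ι K ℚ.* ι K ℚ.+ ℚ.1ℚ) ℚ.- ι (+ 3) ℚ.* (ι H ℚ.* ι H) ℚ.* (ι K ℚ.* ι K)
  lifted = begin
    ι (+ 6) ℚ.* (ι H ℚ.* ι H) ℚ.* ι N₁ ℚ.+ ι (+ 6) ℚ.* (ι K ℚ.* ι K) ℚ.* ι N₂
      ≡⟨ trans (ι-+ (+ 6 * (H * H) * N₁) (+ 6 * (K * K) * N₂)) (cong₂ ℚ._+_ (ι-6a²n H N₁) (ι-6a²n K N₂)) ⟨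
    ι (+ 6 * (H * H) * N₁ + + 6 * (K * K) * N₂)
      ≡⟨ cong ι (dedekindNumerator-reciprocity h′ k′ x y bezout) ⟩
    ι (H * K * (H * H + K * K + 1ℤ) - + 3 * (H * H) * (K * K))
      ≡⟨ ι-- (H * K * (H * H + K * K + 1ℤ)) (+ 3 * (H * H) * (K * K)) ⟩
    ι (H * K * (H * H + K * K + 1ℤ)) ℚ.- ι (+ 3 * (H * H) * (K * K))
      ≡⟨ cong₂ ℚ._-_
           (trans (ι-* (H * K) (H * H + K * K + 1ℤ)) (cong₂ ℚ._*_ (ι-* H K)
             (trans (ι-+ (H * H + K * K) 1ℤ) (cong (ℚ._+ ℚ.1ℚ) (trans (ι-+ (H * H) (K * K)) (cong₂ ℚ._+_ (ι-* H H) (ι-* K K)))))))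
           (trans (ι-* (+ 3 * (H * H)) (K * K)) (cong₂ ℚ._*_ (trans (ι-* (+ 3) (H * H)) (cong (ι (+ 3) ℚ.*_) (ι-* H H))) (ι-* K K))) ⟩
    ι H ℚ.* ι K ℚ.* (ι H ℚ.* ι H ℚ.+ ι K ℚ.* ι K ℚ.+ ℚ.1ℚ) ℚ.- ι (+ 3) ℚ.* (ι H ℚ.* ι H) ℚ.* (ι K ℚ.* ι K) ∎


-- The multiplier ε₁

-- ε₁ (mat α β +[1+ n ] δ) p reduces to ε₁-exponent α δ (suc n).
ε₁-exponent : ℤ → ℤ → (γ : ℕ) → .{{ℕ.NonZero γ}} → ℚ
ε₁-exponent α δ γ = ℚ.- ½ ℚ.+ (+ 3 / 1) ℚ.* ((α + δ) / (12 ℕ.* γ) ℚ.- dedekind δ γ)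
  where instance _ = ℕ.m*n≢0 12 γ

/12-as-* : ∀ i n → i / (12 ℕ.* suc n) ≡ ι i ℚ.* (recip 12 ℚ.* recip (suc n))
/12-as-* i n = trans (/-as-* i (12 ℕ.* suc n)) (cong (ι i ℚ.*_) (recip-* 11 n))

ε₁-exponent-neg : ∀ {x y} α δ n → x * δ + y * + suc n ≡ 1ℤ →
                  ε₁-exponent (- α) (- δ) (suc n) ≡ ℚ.- ℚ.1ℚ ℚ.- ε₁-exponent α δ (suc n)
ε₁-exponent-neg {x} {y} α δ n bezout = begin
  ℚ.- ½ ℚ.+ (+ 3 / 1) ℚ.* ((- α + - δ) / (12 ℕ.* suc n) ℚ.- dedekind (- δ) (suc n))
    ≡⟨ cong₂ (λ p s → ℚ.- ½ ℚ.+ (+ 3 / 1) ℚ.* (p ℚ.- s)) ratio (dedekind-neg {x} {y} δ (suc n) bezout) ⟩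
  ℚ.- ½ ℚ.+ (+ 3 / 1) ℚ.* (ℚ.- (ι (α + δ) ℚ.* w) ℚ.- ℚ.- dedekind δ (suc n))
    ≡⟨ reflect X S ⟩
  ℚ.- ℚ.1ℚ ℚ.- (ℚ.- ½ ℚ.+ (+ 3 / 1) ℚ.* (X ℚ.- S))
    ≡⟨ cong (λ p → ℚ.- ℚ.1ℚ ℚ.- (ℚ.- ½ ℚ.+ (+ 3 / 1) ℚ.* (p ℚ.- S))) (/12-as-* (α + δ) n) ⟨
  ℚ.- ℚ.1ℚ ℚ.- ε₁-exponent α δ (suc n) ∎
  where
  open ≡-Reasoning
  w = recip 12 ℚ.* recip (suc n)
  X = ι (α + δ) ℚ.* w
  S = dedekind δ (suc n)
  reflect : ∀ X S → ℚ.- ½ ℚ.+ (+ 3 / 1) ℚ.* (ℚ.- X ℚ.- ℚ.- S) ≡ ℚ.- ℚ.1ℚ ℚ.- (ℚ.- ½ ℚ.+ (+ 3 / 1) ℚ.* (X ℚ.- S))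
  reflect = ℚ-Solver.solve-∀ ℚ-ring
  ratio : (- α + - δ) / (12 ℕ.* suc n) ≡ ℚ.- (ι (α + δ) ℚ.* w)
  ratio = begin
    (- α + - δ) / (12 ℕ.* suc n)   ≡⟨ cong (λ i → i / (12 ℕ.* suc n)) (ℤ.neg-distrib-+ α δ) ⟨
    (- (α + δ)) / (12 ℕ.* suc n)   ≡⟨ /12-as-* (- (α + δ)) n ⟩
    ι (- (α + δ)) ℚ.* w            ≡⟨ cong (ℚ._* w) (ι-neg (α + δ)) ⟩
    ℚ.- ι (α + δ) ℚ.* w            ≡⟨ ℚ.neg-distribˡ-* (ι (α + δ)) w ⟨
    ℚ.- (ι (α + δ) ℚ.* w)          ∎

ε₁-shift-algebra : ∀ a b c d u v s₁ s₂ → c ℚ.* u ≡ ℚ.1ℚ → d ℚ.* v ≡ ℚ.1ℚ → a ℚ.* d ℚ.- b ℚ.* c ≡ ℚ.1ℚ →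
  s₁ ℚ.+ s₂ ≡ (c ℚ.* v ℚ.+ d ℚ.* u ℚ.+ u ℚ.* v) ℚ.* recip 12 ℚ.- recip 4 →
  (ℚ.- ½ ℚ.+ (+ 3 / 1) ℚ.* ((b ℚ.- c) ℚ.* (recip 12 ℚ.* v) ℚ.- ℚ.- s₁))
    ℚ.- ((- + 3) / 4 ℚ.+ (ℚ.- ½ ℚ.+ (+ 3 / 1) ℚ.* ((a ℚ.+ d) ℚ.* (recip 12 ℚ.* u) ℚ.- s₂))) ≡ ℚ.0ℚ
ε₁-shift-algebra a b c d u v s₁ s₂ cu≡1 dv≡1 det≡1 reciprocity = begin
  (ℚ.- ½ ℚ.+ (+ 3 / 1) ℚ.* ((b ℚ.- c) ℚ.* (recip 12 ℚ.* v) ℚ.- ℚ.- s₁))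
    ℚ.- ((- + 3) / 4 ℚ.+ (ℚ.- ½ ℚ.+ (+ 3 / 1) ℚ.* ((a ℚ.+ d) ℚ.* (recip 12 ℚ.* u) ℚ.- s₂)))
    ≡⟨ ℚ-Solver.solve (a ∷ b ∷ c ∷ d ∷ u ∷ v ∷ s₁ ∷ s₂ ∷ []) ℚ-ring ⟩
  (+ 3 / 1) ℚ.* (s₁ ℚ.+ s₂) ℚ.+ (b ℚ.* v ℚ.- c ℚ.* v ℚ.- a ℚ.* u ℚ.- d ℚ.* u) ℚ.* recip 4 ℚ.+ + 3 / 4
    ≡⟨ cong (λ σ → (+ 3 / 1) ℚ.* σ ℚ.+ (b ℚ.* v ℚ.- c ℚ.* v ℚ.- a ℚ.* u ℚ.- d ℚ.* u) ℚ.* recip 4 ℚ.+ + 3 / 4) reciprocity ⟩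
  (+ 3 / 1) ℚ.* ((c ℚ.* v ℚ.+ d ℚ.* u ℚ.+ u ℚ.* v) ℚ.* recip 12 ℚ.- recip 4)
    ℚ.+ (b ℚ.* v ℚ.- c ℚ.* v ℚ.- a ℚ.* u ℚ.- d ℚ.* u) ℚ.* recip 4 ℚ.+ + 3 / 4
    ≡⟨ ℚ-Solver.solve (a ∷ b ∷ c ∷ d ∷ u ∷ v ∷ []) ℚ-ring ⟩
  (u ℚ.* v ℚ.* ℚ.1ℚ ℚ.+ b ℚ.* v ℚ.* ℚ.1ℚ ℚ.- a ℚ.* u ℚ.* ℚ.1ℚ) ℚ.* recip 4
    ≡⟨ cong₂ (λ p q → (u ℚ.* v ℚ.* p ℚ.+ b ℚ.* v ℚ.* q ℚ.- a ℚ.* u ℚ.* ℚ.1ℚ) ℚ.* recip 4) det≡1 cu≡1 ⟨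
  (u ℚ.* v ℚ.* (a ℚ.* d ℚ.- b ℚ.* c) ℚ.+ b ℚ.* v ℚ.* (c ℚ.* u) ℚ.- a ℚ.* u ℚ.* ℚ.1ℚ) ℚ.* recip 4
    ≡⟨ cong (λ r → (u ℚ.* v ℚ.* (a ℚ.* d ℚ.- b ℚ.* c) ℚ.+ b ℚ.* v ℚ.* (c ℚ.* u) ℚ.- a ℚ.* u ℚ.* r) ℚ.* recip 4) dv≡1 ⟨
  (u ℚ.* v ℚ.* (a ℚ.* d ℚ.- b ℚ.* c) ℚ.+ b ℚ.* v ℚ.* (c ℚ.* u) ℚ.- a ℚ.* u ℚ.* (d ℚ.* v)) ℚ.* recip 4
    ≡⟨ ℚ-Solver.solve (a ∷ b ∷ c ∷ d ∷ u ∷ v ∷ []) ℚ-ring ⟩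
  ℚ.0ℚ ∎
  where open ≡-Reasoning

det-as-bezout : ∀ a b c d → - b * c + a * d ≡ a * d - b * c
det-as-bezout a b c d = solve (a ∷ b ∷ c ∷ d ∷ [])

ε₁-exponent-shift : ∀ a b C′ D′ → a * +[1+ D′ ] - b * +[1+ C′ ] ≡ 1ℤ →
  ε₁-exponent b (- +[1+ C′ ]) (suc D′) ℚ.- ((- + 3) / 4 ℚ.+ ε₁-exponent a +[1+ D′ ] (suc C′)) ≡ ℚ.0ℚ
ε₁-exponent-shift a b C′ D′ det = begin
  ε₁-exponent b (- c) (suc D′) ℚ.- ((- + 3) / 4 ℚ.+ ε₁-exponent a d (suc C′))
    ≡⟨ cong₂ (λ X Y → (ℚ.- ½ ℚ.+ (+ 3 / 1) ℚ.* X) ℚ.- ((- + 3) / 4 ℚ.+ (ℚ.- ½ ℚ.+ (+ 3 / 1) ℚ.* Y))) first second ⟩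
  (ℚ.- ½ ℚ.+ (+ 3 / 1) ℚ.* ((ι b ℚ.- ι c) ℚ.* (recip 12 ℚ.* v) ℚ.- ℚ.- dedekind c (suc D′)))
    ℚ.- ((- + 3) / 4 ℚ.+ (ℚ.- ½ ℚ.+ (+ 3 / 1) ℚ.* ((ι a ℚ.+ ι d) ℚ.* (recip 12 ℚ.* u) ℚ.- dedekind d (suc C′))))
    ≡⟨ ε₁-shift-algebra (ι a) (ι b) (ι c) (ι d) u v (dedekind c (suc D′)) (dedekind d (suc C′))
         (ι-*-recip (suc C′)) (ι-*-recip (suc D′)) det-ℚ (dedekind-reciprocity C′ D′ (- b) a bezout) ⟩
  ℚ.0ℚ ∎
  where
  open ≡-Reasoning
  c = +[1+ C′ ]
  d = +[1+ D′ ]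
  u = recip (suc C′)
  v = recip (suc D′)
  bezout : - b * c + a * d ≡ 1ℤ
  bezout = trans (det-as-bezout a b c d) det
  det-ℚ : ι a ℚ.* ι d ℚ.- ι b ℚ.* ι c ≡ ℚ.1ℚ
  det-ℚ = trans (sym (trans (ι-- (a * d) (b * c)) (cong₂ ℚ._-_ (ι-* a d) (ι-* b c)))) (cong ι det)
  first : (b + - c) / (12 ℕ.* suc D′) ℚ.- dedekind (- c) (suc D′)
        ≡ (ι b ℚ.- ι c) ℚ.* (recip 12 ℚ.* v) ℚ.- ℚ.- dedekind c (suc D′)
  first = cong₂ ℚ._-_ (trans (/12-as-* (b + - c) D′) (cong (ℚ._* (recip 12 ℚ.* v)) (ι-- b c)))
                      (dedekind-neg {x = - b} {y = a} c (suc D′) bezout)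
  second : (a + d) / (12 ℕ.* suc C′) ℚ.- dedekind d (suc C′)
         ≡ (ι a ℚ.+ ι d) ℚ.* (recip 12 ℚ.* u) ℚ.- dedekind d (suc C′)
  second = cong (ℚ._- dedekind d (suc C′)) (trans (/12-as-* (a + d) C′) (cong (ℚ._* (recip 12 ℚ.* u)) (ι-+ a d)))

mat-cong : ∀ {α α′ β β′ γ γ′ δ δ′} → α ≡ α′ → β ≡ β′ → γ ≡ γ′ → δ ≡ δ′ →
           mat α β γ δ ≡ mat α′ β′ γ′ δ′
mat-cong refl refl refl refl = refl

·S : ∀ a b c d → mat a b c d · mat 0ℤ (- + 1) (+ 1) 0ℤ ≡ mat b (- a) d (- c)
·S a b c d = mat-cong (solve (a ∷ b ∷ [])) (solve (a ∷ b ∷ [])) (solve (c ∷ d ∷ [])) (solve (c ∷ d ∷ []))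

·S⁻¹ : ∀ a b c d → mat a b c d · mat 0ℤ (+ 1) (- + 1) 0ℤ ≡ mat (- b) a (- d) c
·S⁻¹ a b c d = mat-cong (solve (a ∷ b ∷ [])) (solve (a ∷ b ∷ [])) (solve (c ∷ d ∷ [])) (solve (c ∷ d ∷ []))

ε₁-cong : ∀ {M N} → M ≡ N → (p : 0ℤ < γ M) (q : 0ℤ < γ N) → ε₁ M p ≡ ε₁ N q
ε₁-cong refl p q = cong (ε₁ _) (ℤ.<-irrelevant p q)

ε₁-·S : ∀ a b C′ D′ → let A = mat a b +[1+ C′ ] +[1+ D′ ] in IsSL2 A →
  (p : 0ℤ < γ (A · mat 0ℤ (- + 1) (+ 1) 0ℤ)) (q : 0ℤ < +[1+ C′ ]) →
  ε₁ (A · mat 0ℤ (- + 1) (+ 1) 0ℤ) p ≈ᵤ e^πi (- + 3 / 4) ⊙ ε₁ A q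
ε₁-·S a b C′ D′ det p q = 0ℤ ,
  trans (cong (ℚ._- ((- + 3) / 4 ℚ.+ ε₁-exponent a +[1+ D′ ] (suc C′)))
              (ε₁-cong (·S a b +[1+ C′ ] +[1+ D′ ]) p (+<+ (s≤s z≤n))))
        (ε₁-exponent-shift a b C′ D′ det)

conjugate-shift : ∀ X Y Z W → X ℚ.- ((- + 3) / 4 ℚ.+ Z) ≡ ℚ.0ℚ → W ≡ ℚ.- ℚ.1ℚ ℚ.- X → Z ≡ ℚ.- ℚ.1ℚ ℚ.- Y →
                  W ℚ.- (+ 3 / 4 ℚ.+ Y) ≡ ℚ.0ℚ
conjugate-shift X Y Z W shift refl refl = begin
  ℚ.- ℚ.1ℚ ℚ.- X ℚ.- (+ 3 / 4 ℚ.+ Y)                  ≡⟨ ℚ-Solver.solve (X ∷ Y ∷ []) ℚ-ring ⟩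
  ℚ.- (X ℚ.- ((- + 3) / 4 ℚ.+ (ℚ.- ℚ.1ℚ ℚ.- Y)))     ≡⟨ cong ℚ.-_ shift ⟩
  ℚ.0ℚ                                                 ∎
  where open ≡-Reasoning

ε₁-·S⁻¹ : ∀ a b C′ D′ → let A = mat a b +[1+ C′ ] -[1+ D′ ] in IsSL2 A →
  (p : 0ℤ < γ (A · mat 0ℤ (+ 1) (- + 1) 0ℤ)) (q : 0ℤ < +[1+ C′ ]) →
  ε₁ (A · mat 0ℤ (+ 1) (- + 1) 0ℤ) p ≈ᵤ e^πi (+ 3 / 4) ⊙ ε₁ A q
ε₁-·S⁻¹ a b C′ D′ det p q = 0ℤ ,
  trans (cong (ℚ._- (+ 3 / 4 ℚ.+ ε₁-exponent a (- d) (suc C′)))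
              (ε₁-cong (·S⁻¹ a b c (- d)) p (+<+ (s≤s z≤n))))
        (conjugate-shift (ε₁-exponent b (- c) (suc D′)) (ε₁-exponent a (- d) (suc C′))
                         (ε₁-exponent (- a) d (suc C′)) (ε₁-exponent (- b) c (suc D′))
          (ε₁-exponent-shift (- a) b C′ D′ det′)
          (ε₁-exponent-neg {x = b} {y = - a} b (- c) D′ (trans (swap-bezout a b c d) det′))
          (ε₁-exponent-neg {x = a} {y = - b} a (- d) C′ (trans (neg-bezout a b c d) det)))
  where
  c = +[1+ C′ ]
  d = +[1+ D′ ]
  neg-det : ∀ w x y z → - w * z - x * y ≡ w * (- z) - x * y
  neg-det w x y z = solve (w ∷ x ∷ y ∷ z ∷ [])
  swap-bezout : ∀ w x y z → x * (- y) + (- w) * z ≡ - w * z - x * y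
  swap-bezout w x y z = solve (w ∷ x ∷ y ∷ z ∷ [])
  neg-bezout : ∀ w x y z → w * (- z) + (- x) * y ≡ w * (- z) - x * y
  neg-bezout w x y z = solve (w ∷ x ∷ y ∷ z ∷ [])
  det′ : - a * d - b * c ≡ 1ℤ
  det′ = trans (neg-det a b c d) det

lemma2 : (a b c d : ℤ) → IsSL2 (mat a b c d) → (c>0 : 0ℤ < c) → ¬ (d ≡ 0ℤ) →
    (0ℤ < d →
      (p : 0ℤ < γ (mat a b c d · mat 0ℤ (- + 1) (+ 1) 0ℤ)) →
      ε₁ (mat a b c d · mat 0ℤ (- + 1) (+ 1) 0ℤ) p
        ≈ᵤ e^πi (- + 3 / 4) ⊙ ε₁ (mat a b c d) c>0)
    × (d < 0ℤ →
      (p : 0ℤ < γ (mat a b c d · mat 0ℤ (+ 1) (- + 1) 0ℤ)) →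
      ε₁ (mat a b c d · mat 0ℤ (+ 1) (- + 1) 0ℤ) p
        ≈ᵤ e^πi (+ 3 / 4) ⊙ ε₁ (mat a b c d) c>0)
lemma2 a b (+ zero)  d          _   (+<+ ()) _
lemma2 a b -[1+ _ ]  d          _   ()       _
lemma2 a b +[1+ C′ ] +[1+ D′ ] det c>0 _    = (λ _ p → ε₁-·S a b C′ D′ det p c>0) , λ { (+<+ ()) }
lemma2 a b +[1+ C′ ] (+ zero)  _   _   d≢0  = ⊥-elim (d≢0 refl)
lemma2 a b +[1+ C′ ] -[1+ D′ ] det c>0 _    = (λ ()) , (λ _ p → ε₁-·S⁻¹ a b C′ D′ det p c>0)
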